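{- Let $\Xi_{QU}=(g,m,n;\Pi_1,\Pi_2)$ be a quasi-one-face passport with $g>0$. Then there exists a labeled hypermap with passport $\Xi_{QU}$, i.e. $\mathcal M(\Xi_{QU})\neq\varnothing$.
   Context: A hypermap of genus $g$ with $n$ edges is a connected graph with black and white vertices, every edge joining a black and a white vertex (multiple edges allowed), embedded in a closed oriented surface of genus $g$ with all faces open disks; vertex weight = degree, face weight = half the number of edge-sides on the face boundary. A passport $(g,n;\Pi_1,\Pi_2,\Pi_3)$ consists of $\Pi_k=(S_k,\lambda_k,\mathrm{wt}_k)$, $S_k$ finite nonempty, $\lambda_k,\mathrm{wt}_k:S_k\to\mathbb Z_{>0}$, with $\sum_{s}\lambda_k(s)\mathrm{wt}_k(s)=n$ for each $k$ and $\sum_k\sum_s\lambda_k(s)-n=2-2g$. A labeled hypermap with this passport is a hypermap of genus $g$ with $n$ edges with labelings of black vertices, white vertices and faces by $S_1,S_2,S_3$ such that each element labelled $s$ has weight $\mathrm{wt}_k(s)$ and each $s\in S_k$ labels exactly $\lambda_k(s)$ elements. $\mathcal M(\Xi)$ is the set of isomorphism classes (orientation-preserving homeomorphisms preserving colours and labels). A quasi-one-face passport $(g,m,n;\Pi_1,\Pi_2)$, $1\le m\le n$, is a passport whose face data prescribes exactly one face of weight $m$ and $n-m$ faces of weight $1$. -}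

module Defs where

open import Data.Nat using (ℕ; zero; suc; _+_; _*_; _∸_; _≤_; _<_)
open import Data.Fin using (Fin; zero; suc)
open import Data.Fin.Permutation using (Permutation′; _⟨$⟩ʳ_)
open import Data.Product using (Σ; ∃; _×_; _,_; proj₁)
open import Data.List using (List; []; _∷_; _++_; replicate)
open import Data.List.Relation.Binary.Permutation.Propositional using (_↭_)
open import Relation.Binary.PropositionalEquality using (_≡_; _≢_)

∑ : ∀ {k} → (Fin k → ℕ) → ℕ
∑ {zero}  f = 0
∑ {suc k} f = f zero + ∑ (λ i → f (suc i))

record Datum : Set where
  field
    size     : ℕ
    nonempty : 1 ≤ size
    mult     : Fin size → ℕ
    wt       : Fin size → ℕ
    mult-pos : ∀ s → 1 ≤ mult s
    wt-pos   : ∀ s → 1 ≤ wt s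
open Datum public

count : Datum → ℕ
count Π = ∑ (mult Π)

total : Datum → ℕ
total Π = ∑ (λ s → mult Π s * wt Π s)

weightsFrom : ∀ {k} → (Fin k → ℕ) → (Fin k → ℕ) → List ℕ
weightsFrom {zero}  m w = []
weightsFrom {suc k} m w = replicate (m zero) (w zero) ++ weightsFrom (λ i → m (suc i)) (λ i → w (suc i))

weights : Datum → List ℕ
weights Π = weightsFrom (mult Π) (wt Π)

record Passport : Set where
  field
    genus : ℕ
    edges : ℕ
    Π₁ Π₂ Π₃ : Datum
    total₁ : total Π₁ ≡ edges
    total₂ : total Π₂ ≡ edges
    total₃ : total Π₃ ≡ edges
    -- Σ_k Σ_s λ_k(s) - n = 2 - 2g, written in ℕ
    euler  : count Π₁ + count Π₂ + count Π₃ + 2 * genus ≡ edges + 2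
open Passport public

IsQuasiOneFace : ℕ → Passport → Set
IsQuasiOneFace m Ξ =
  (1 ≤ m) × (m ≤ edges Ξ) × (weights (Π₃ Ξ) ↭ (m ∷ replicate (edges Ξ ∸ m) 1))

-- Combinatorial hypermaps: darts = edges = Fin n, σ (black vertices),
-- α (white vertices), φ (faces) with φ ∘ α ∘ σ = id, and the group
-- ⟨σ, α⟩ acting transitively (connectedness).  Cycles of σ / α / φ are
-- black vertices / white vertices / faces; a cycle's length is the
-- degree of the vertex, resp. the (half-)weight of the face.

iter : ∀ {n} → Permutation′ n → ℕ → Fin n → Fin n
iter π zero    x = x
iter π (suc k) x = π ⟨$⟩ʳ iter π k x

InOrbit : ∀ {n} → Permutation′ n → Fin n → Fin n → Set
InOrbit π x y = ∃ λ k → iter π k x ≡ y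

CycleLength : ∀ {n} → Permutation′ n → Fin n → ℕ → Set
CycleLength π x k = (1 ≤ k) × (iter π k x ≡ x) × (∀ j → 1 ≤ j → j < k → iter π j x ≢ x)

data Reach {n} (σ α : Permutation′ n) (x : Fin n) : Fin n → Set where
  here : Reach σ α x x
  stepσ : ∀ {y} → Reach σ α x y → Reach σ α x (σ ⟨$⟩ʳ y)
  stepα : ∀ {y} → Reach σ α x y → Reach σ α x (α ⟨$⟩ʳ y)

record Hypermap (n : ℕ) : Set where
  field
    σ α φ     : Permutation′ n
    product   : ∀ x → φ ⟨$⟩ʳ (α ⟨$⟩ʳ (σ ⟨$⟩ʳ x)) ≡ x
    connected : ∀ x y → Reach σ α x y
open Hypermap public

-- Slots: pairs (s, i) with s ∈ S, i < λ(s); a labeling of the cycles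
-- of π by Π is a bijection cycles ≅ slots (so s labels exactly λ(s)
-- cycles), given by a representative dart for each slot, such that
-- the cycle labelled s has length wt(s).
Slot : Datum → Set
Slot Π = Σ (Fin (size Π)) (λ s → Fin (mult Π s))

record CycleLabeling {n} (π : Permutation′ n) (Π : Datum) : Set where
  field
    rep    : Slot Π → Fin n
    len    : ∀ p → CycleLength π (rep p) (wt Π (proj₁ p))
    unique : ∀ y → ∃ λ p → InOrbit π (rep p) y × (∀ q → InOrbit π (rep q) y → q ≡ p)

-- A labeled hypermap with passport Ξ (genus is then forced to be
-- genus Ξ by the Euler relation built into the passport).
record LabeledHypermap (Ξ : Passport) : Set where
  field
    map : Hypermap (edges Ξ)
    lab₁ : CycleLabeling (σ map) (Π₁ Ξ)
    lab₂ : CycleLabeling (α map) (Π₂ Ξ)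
    lab₃ : CycleLabeling (φ map) (Π₃ Ξ)

module Submission where

-- A hypermap is built as two permutations σ (black vertices) and α (white vertices) of the darts
-- 0 … n-1 such that α ∘ σ has one cycle F of length m and fixes every other dart; the cycles
-- are kept as lists. With ls and ms the black and white degrees, Euler's relation reads
-- |ls| + |ms| + 2g = m + 1.
--
-- For g > 0 some degree p is at least 3, since otherwise n ≤ |ls| + |ms| ≤ m - 1 < n. Realize the
-- data with p replaced by p - 2, 1, 1, which has genus g - 1, and merge these three black
-- vertices again: each of them has a dart on F, and precomposing σ with the 3-cycle of those
-- darts, taken in their order along F, joins the vertices and keeps F a single face.
--
-- In genus 0, reached only through such splittings, a degree 1 is available. If there is
-- another one, remove a leaf hanging from a vertex of degree at least 2. Otherwise let s ≥ 2 be
-- the least remaining degree, remove a vertex of degree s and lower a larger degree on the other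
-- side by s; reattaching it as a leaf on F followed by s - 1 parallel edges (each bounding a new
-- face of weight 1) undoes this, and (K - 2)(s - 2) ≥ 0 for the number K ≥ 3 of vertices other
-- than the leaf keeps m ≤ n.

open import Defs hiding (σ; α; φ; product; connected)

open import Data.Empty using (⊥; ⊥-elim)
open import Data.Fin as Fin using (Fin; toℕ; fromℕ<)
open import Data.Fin.Permutation using (Permutation′; permutation; _⟨$⟩ʳ_)
open import Data.Fin.Properties using (toℕ-injective; toℕ<n; toℕ-fromℕ<; fromℕ<-toℕ)
open import Data.List using (List; []; _∷_; _++_; [_]; map; concat; length; reverse; _∷ʳ_; downFrom; zip; replicate; allFin; tabulate)
open import Data.List.Extrema.Nat using (min; min≤⊤; min≤xs; argmin-sel)
open import Data.List.Membership.Propositional using (_∈_; find; lose)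
open import Data.List.Membership.Propositional.Properties using (∈-++⁺ˡ; ∈-++⁺ʳ; ∈-++⁻; ∈-∃++; ∈-map⁺; ∈-map⁻; ∈-concat⁺′; ∈-concat⁻′; ∈-downFrom⁺; ∈-downFrom⁻; ∈-allFin)
open import Data.List.Membership.Propositional.Properties.WithK using (unique∧set⇒bag)
open import Data.List.Properties using (++-assoc; ++-identityʳ; unfold-reverse; length-++; map-++; length-map; map-∘; ∷-injectiveˡ; ∷-injectiveʳ; length-reverse; length-downFrom; concat-map-[_]; length-replicate)
open import Data.List.Relation.Binary.BagAndSetEquality using (∼bag⇒↭)
import Data.List.Relation.Binary.Permutation.Propositional as ↭
open import Data.List.Relation.Binary.Permutation.Propositional using (_↭_; ↭-refl; ↭-sym; ↭-trans; ↭-reflexive; prep; swap; ↭⇒↭ₛ; module PermutationReasoning)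
open import Data.List.Relation.Binary.Permutation.Propositional.Properties using (∈-resp-↭; Any-resp-↭; All-resp-↭; shift; shifts; ++-comm; ++⁺ˡ; ++⁺ʳ; ↭-map-inv; ↭-length; ↭-reverse)
import Data.List.Relation.Binary.Permutation.Setoid.Properties as Setoid↭
open import Data.List.Relation.Unary.All as All using (All; []; _∷_)
open import Data.List.Relation.Unary.All.Properties using (++⁺; ++⁻ˡ; ++⁻ʳ; map⁺; replicate⁺; ¬Any⇒All¬)
open import Data.List.Relation.Unary.AllPairs using ([]; _∷_)
open import Data.List.Relation.Unary.Any as Any using (Any; here; there; any?)
open import Data.List.Relation.Unary.Unique.Propositional using (Unique)
open import Data.List.Relation.Unary.Unique.Propositional.Properties as Unique using (downFrom⁺; allFin⁺; Unique[x∷xs]⇒x∉xs)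
open import Data.Nat using (ℕ; zero; suc; pred; _+_; _*_; _∸_; _<_; _≤_; s≤s; z≤n; _≟_; _≤?_; _<?_)
open import Data.List.Membership.DecPropositional _≟_ using (_∈?_)
open import Data.Nat.Induction using (<-rec)
open import Data.Nat.ListAction using (sum)
open import Data.Nat.ListAction.Properties using (sum-↭; sum-++)
open import Data.Nat.Properties using (<⇒≢; >⇒≢; <⇒≤; ≤-refl; ≤-trans; ≤-antisym; ≤-pred; <-irrefl; ≮⇒≥; ≰⇒>; n<1+n; m<n⇒m<1+n; m<1+n⇒m<n∨m≡n; m≤m+n; m≤n+m; m<n⇒0<n∸m; m+[n∸m]≡n; m+n∸m≡n; suc-injective; +-suc; +-comm; +-assoc; +-identityʳ; *-comm; *-identityʳ; +-cancelˡ-≡; +-cancelʳ-≤; +-mono-≤; +-monoˡ-≤; +-monoʳ-≤; *-monoˡ-≤; *-monoʳ-≤; *-cancelˡ-≤; module ≤-Reasoning)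
open import Data.Nat.Tactic.RingSolver using (solve-∀)
open import Data.Product using (Σ; ∃; ∃₂; _×_; _,_; proj₁; proj₂)
open import Data.Sum using (_⊎_; inj₁; inj₂)
open import Function.Bundles using (mk⇔)
open import Relation.Binary.PropositionalEquality using (_≡_; _≢_; refl; sym; trans; cong; cong₂; subst; subst₂; setoid; module ≡-Reasoning)
open import Relation.Nullary using (¬_; yes; no)

Unique-resp-↭ : ∀ {xs ys : List ℕ} → xs ↭ ys → Unique xs → Unique ys
Unique-resp-↭ p = Setoid↭.Unique-resp-↭ (setoid ℕ) (↭⇒↭ₛ p)

Unique-++⁻ˡ : ∀ (xs : List ℕ) {ys} → Unique (xs ++ ys) → Unique xs
Unique-++⁻ˡ [] _ = []
Unique-++⁻ˡ (x ∷ xs) (x≢ ∷ u) = ++⁻ˡ xs x≢ ∷ Unique-++⁻ˡ xs u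

Unique-++⁻ʳ : ∀ (xs : List ℕ) {ys} → Unique (xs ++ ys) → Unique ys
Unique-++⁻ʳ [] u = u
Unique-++⁻ʳ (x ∷ xs) (_ ∷ u) = Unique-++⁻ʳ xs u

Unique-++-disjoint : ∀ (xs : List ℕ) {ys z} → Unique (xs ++ ys) → z ∈ xs → z ∈ ys → ⊥
Unique-++-disjoint (x ∷ xs) u (here refl) z∈ys = Unique[x∷xs]⇒x∉xs u (∈-++⁺ʳ xs z∈ys)
Unique-++-disjoint (x ∷ xs) (_ ∷ u) (there z∈xs) z∈ys = Unique-++-disjoint xs u z∈xs z∈ys

Unique-∷⇒≢ : ∀ {x : ℕ} {xs z} → Unique (x ∷ xs) → z ∈ xs → z ≢ x
Unique-∷⇒≢ u z∈xs refl = Unique[x∷xs]⇒x∉xs u z∈xs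

Unique-concat⁻ : ∀ {Cs : List (List ℕ)} {C} → Unique (concat Cs) → C ∈ Cs → Unique C
Unique-concat⁻ {C ∷ _} u (here refl) = Unique-++⁻ˡ C u
Unique-concat⁻ {C′ ∷ _} u (there C∈) = Unique-concat⁻ (Unique-++⁻ʳ C′ u) C∈

Unique-map⁺-on : ∀ (f : ℕ → ℕ) {L} → (∀ {x y} → x ∈ L → y ∈ L → f x ≡ f y → x ≡ y) → Unique L → Unique (map f L)
Unique-map⁺-on f {[]} _ _ = []
Unique-map⁺-on f {x ∷ L} inj (x≢ ∷ u) =
  All.tabulate fx≢ ∷ Unique-map⁺-on f (λ p q → inj (there p) (there q)) u
  where
  fx≢ : ∀ {z} → z ∈ map f L → f x ≢ z
  fx≢ z∈ e with ∈-map⁻ f z∈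
  ... | y , y∈ , refl = All.lookup x≢ y∈ (inj (here refl) (there y∈) e)

Unique-↭downFrom : ∀ {xs n} → xs ↭ downFrom n → Unique xs
Unique-↭downFrom {n = n} p = Unique-resp-↭ (↭-sym p) (downFrom⁺ n)

∈-↭downFrom⁻ : ∀ {xs n x} → xs ↭ downFrom n → x ∈ xs → x < n
∈-↭downFrom⁻ p x∈ = ∈-downFrom⁻ (∈-resp-↭ p x∈)

unique∧sameMembers⇒↭ : ∀ {xs ys : List ℕ} → Unique xs → Unique ys →
                       (∀ {z} → z ∈ xs → z ∈ ys) → (∀ {z} → z ∈ ys → z ∈ xs) → xs ↭ ys
unique∧sameMembers⇒↭ u v to from = ∼bag⇒↭ (unique∧set⇒bag u v (mk⇔ to from))

↭-rotate : ∀ (xs : List ℕ) c ys → xs ++ c ∷ ys ↭ c ∷ ys ++ xs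
↭-rotate xs c ys = ↭-trans (shift c xs ys) (prep c (++-comm xs ys))

∈⇒↭∷ : ∀ {x : ℕ} {L} → x ∈ L → ∃ λ L′ → L ↭ x ∷ L′
∈⇒↭∷ x∈ with ∈-∃++ x∈
... | xs , ys , refl = xs ++ ys , shift _ xs ys

head-∈ : ∀ {s : ℕ} L → 1 ≤ length L → All (_≡ s) L → s ∈ L
head-∈ (x ∷ L) _ (x≡s ∷ _) = here (sym x≡s)

↭-concat : ∀ {xss yss : List (List ℕ)} → xss ↭ yss → concat xss ↭ concat yss
↭-concat ↭.refl = ↭-refl
↭-concat (prep xs p) = ++⁺ˡ xs (↭-concat p)
↭-concat (swap xs ys p) = ↭-trans (shifts xs ys) (++⁺ˡ ys (++⁺ˡ xs (↭-concat p)))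
↭-concat (↭.trans p q) = ↭-trans (↭-concat p) (↭-concat q)

Chain : (ℕ → ℕ) → ℕ → List ℕ → ℕ → Set
Chain f x [] t = f x ≡ t
Chain f x (y ∷ ys) t = f x ≡ y × Chain f y ys t

Cycle : (ℕ → ℕ) → List ℕ → Set
Cycle f [] = ⊥
Cycle f (x ∷ xs) = Chain f x xs x

Chain-++⁻ : ∀ {f x t y} xs {ys} → Chain f x (xs ++ y ∷ ys) t → Chain f x xs y × Chain f y ys t
Chain-++⁻ [] (e , c) = e , c
Chain-++⁻ (_ ∷ xs) (e , c) with Chain-++⁻ xs c
... | c₁ , c₂ = (e , c₁) , c₂

Chain-++⁺ : ∀ {f x t y} xs {ys} → Chain f x xs y → Chain f y ys t → Chain f x (xs ++ y ∷ ys) t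
Chain-++⁺ [] e c = e , c
Chain-++⁺ (_ ∷ xs) (e , c₁) c₂ = e , Chain-++⁺ xs c₁ c₂

Chain-transfer : ∀ {f g x x′ t} xs → Chain f x xs t → g x′ ≡ f x → (∀ {z} → z ∈ xs → g z ≡ f z) → Chain g x′ xs t
Chain-transfer [] c e _ = trans e c
Chain-transfer (y ∷ xs) (e₁ , c) e agree =
  trans e e₁ , Chain-transfer xs c (agree (here refl)) (λ z∈ → agree (there z∈))

Cycle-cong : ∀ {f g} C → Cycle f C → (∀ {z} → z ∈ C → g z ≡ f z) → Cycle g C
Cycle-cong (x ∷ xs) c agree = Chain-transfer xs c (agree (here refl)) (λ z∈ → agree (there z∈))

Cycle-rotate : ∀ {f} xs c ys → Cycle f (xs ++ c ∷ ys) → Cycle f (c ∷ ys ++ xs)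
Cycle-rotate [] c ys cy = subst (λ zs → Chain _ c zs c) (sym (++-identityʳ ys)) cy
Cycle-rotate (x ∷ xs) c ys cy with Chain-++⁻ xs cy
... | c₁ , c₂ = Chain-++⁺ ys c₂ c₁

Chain-map : ∀ {f g} h {x t} xs → Chain f x xs t → (∀ {z} → z ∈ x ∷ xs → g (h z) ≡ h (f z)) →
            Chain g (h x) (map h xs) (h t)
Chain-map h [] c comm = trans (comm (here refl)) (cong h c)
Chain-map h (y ∷ xs) (e , c) comm = trans (comm (here refl)) (cong h e) , Chain-map h xs c (λ z∈ → comm (there z∈))

Chain-reverse : ∀ {f g x t} xs → Chain f x xs t → (∀ {z} → z ∈ x ∷ xs → g (f z) ≡ z) → Chain g t (reverse xs) x
Chain-reverse [] c inv = trans (cong _ (sym c)) (inv (here refl))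
Chain-reverse {g = g} {t = t} (y ∷ xs) (e , c) inv =
  subst (λ zs → Chain g t zs _) (sym (unfold-reverse y xs))
    (Chain-++⁺ (reverse xs) (Chain-reverse xs c (λ z∈ → inv (there z∈))) (trans (cong g (sym e)) (inv (here refl))))

Chain-closed : ∀ {f x t z} xs → Chain f x xs t → z ∈ x ∷ xs → f z ∈ xs ∷ʳ t
Chain-closed [] c (here refl) = here c
Chain-closed (y ∷ xs) (e , c) (here refl) = here e
Chain-closed (y ∷ xs) (e , c) (there z∈) = there (Chain-closed xs c z∈)

Cycle-closed : ∀ {f z} C → Cycle f C → z ∈ C → f z ∈ C
Cycle-closed (x ∷ xs) c z∈ with ∈-++⁻ xs (Chain-closed xs c z∈)
... | inj₁ fz∈ = there fz∈
... | inj₂ (here refl) = here refl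

Chain-preimage : ∀ {f x t z} xs → Chain f x xs t → z ∈ xs ∷ʳ t → ∃ λ p → p ∈ x ∷ xs × f p ≡ z
Chain-preimage [] c (here refl) = _ , here refl , c
Chain-preimage (y ∷ xs) (e , c) (here refl) = _ , here refl , e
Chain-preimage (y ∷ xs) (e , c) (there z∈) with Chain-preimage xs c z∈
... | p , p∈ , fp = p , there p∈ , fp

Cycle-preimage : ∀ {f z} C → Cycle f C → z ∈ C → ∃ λ p → p ∈ C × f p ≡ z
Cycle-preimage (x ∷ xs) c (here refl) = Chain-preimage xs c (∈-++⁺ʳ xs (here refl))
Cycle-preimage (x ∷ xs) c (there z∈) = Chain-preimage xs c (∈-++⁺ˡ z∈)

iterate : (ℕ → ℕ) → ℕ → ℕ → ℕ
iterate f zero x = x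
iterate f (suc k) x = f (iterate f k x)

iterate-suc : ∀ f k x → iterate f (suc k) x ≡ iterate f k (f x)
iterate-suc f zero x = refl
iterate-suc f (suc k) x = cong f (iterate-suc f k x)

Chain-iterate-∈ : ∀ {f x t} xs → Chain f x xs t → ∀ j → 1 ≤ j → j ≤ length xs → iterate f j x ∈ xs
Chain-iterate-∈ (y ∷ xs) (e , c) (suc zero) _ _ = here e
Chain-iterate-∈ {f} {x} (y ∷ xs) (e , c) (suc (suc j)) _ (s≤s j≤) =
  there (subst (_∈ xs) (sym (trans (iterate-suc f (suc j) x) (cong (iterate f (suc j)) e)))
                       (Chain-iterate-∈ xs c (suc j) (s≤s z≤n) j≤))

Chain-iterate-end : ∀ {f x t} xs → Chain f x xs t → iterate f (suc (length xs)) x ≡ t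
Chain-iterate-end [] c = c
Chain-iterate-end {f} {x} (y ∷ xs) (e , c) =
  trans (iterate-suc f (suc (length xs)) x) (trans (cong (iterate f (suc (length xs))) e) (Chain-iterate-end xs c))

Chain-reaches : ∀ {f x t z} xs → Chain f x xs t → z ∈ x ∷ xs → ∃ λ k → iterate f k x ≡ z
Chain-reaches xs c (here refl) = 0 , refl
Chain-reaches {f} {x} (y ∷ xs) (e , c) (there z∈) with Chain-reaches xs c z∈
... | k , eq = suc k , trans (iterate-suc f k x) (trans (cong (iterate f k) e) eq)

Cycle-iterate-∈ : ∀ {f x} C → Cycle f C → x ∈ C → ∀ k → iterate f k x ∈ C
Cycle-iterate-∈ C cy x∈ zero = x∈
Cycle-iterate-∈ C cy x∈ (suc k) = Cycle-closed C cy (Cycle-iterate-∈ C cy x∈ k)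

Cycle-reaches : ∀ {f} C → Cycle f C → ∀ {x z} → x ∈ C → z ∈ C → ∃ λ k → iterate f k x ≡ z
Cycle-reaches C cy {x} x∈ z∈ with ∈-∃++ x∈
... | xs , ys , refl = Chain-reaches (ys ++ xs) (Cycle-rotate xs x ys cy) (∈-resp-↭ (↭-rotate xs x ys) z∈)

++-assoc₃ : ∀ (X₁ : List ℕ) b X₂ c X₃ T → (X₁ ++ b ∷ X₂ ++ c ∷ X₃) ++ T ≡ X₁ ++ b ∷ X₂ ++ c ∷ X₃ ++ T
++-assoc₃ X₁ b X₂ c X₃ T =
  trans (++-assoc X₁ _ T) (cong (λ L → X₁ ++ b ∷ L) (++-assoc X₂ (c ∷ X₃) T))

↭-gather₃ : ∀ a (X₁ : List ℕ) b X₂ c X₃ → a ∷ X₁ ++ b ∷ X₂ ++ c ∷ X₃ ↭ a ∷ b ∷ c ∷ X₁ ++ X₂ ++ X₃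
↭-gather₃ a X₁ b X₂ c X₃ = prep a (begin
  X₁ ++ b ∷ X₂ ++ c ∷ X₃       ↭⟨ shift b X₁ _ ⟩
  b ∷ X₁ ++ X₂ ++ c ∷ X₃       ≡⟨ cong (b ∷_) (sym (++-assoc X₁ X₂ _)) ⟩
  b ∷ (X₁ ++ X₂) ++ c ∷ X₃     ↭⟨ prep b (shift c (X₁ ++ X₂) X₃) ⟩
  b ∷ c ∷ (X₁ ++ X₂) ++ X₃     ≡⟨ cong (λ L → b ∷ c ∷ L) (++-assoc X₁ X₂ X₃) ⟩
  b ∷ c ∷ X₁ ++ X₂ ++ X₃       ∎)
  where open PermutationReasoning

↭-rotate-pieces₃ : ∀ c₁ (X₁ : List ℕ) c₂ X₂ c₃ X₃ T →
                   (c₁ ∷ X₂ ++ c₂ ∷ X₃ ++ c₃ ∷ X₁) ++ T ↭ c₁ ∷ X₁ ++ c₂ ∷ X₂ ++ c₃ ∷ X₃ ++ T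
↭-rotate-pieces₃ c₁ X₁ c₂ X₂ c₃ X₃ T = begin
  c₁ ∷ (X₂ ++ c₂ ∷ X₃ ++ c₃ ∷ X₁) ++ T  ≡⟨ cong (c₁ ∷_) (++-assoc₃ X₂ c₂ X₃ c₃ X₁ T) ⟩
  c₁ ∷ X₂ ++ c₂ ∷ X₃ ++ c₃ ∷ X₁ ++ T    ↭⟨ ↭-gather₃ c₁ X₂ c₂ X₃ c₃ (X₁ ++ T) ⟩
  c₁ ∷ c₂ ∷ c₃ ∷ X₂ ++ X₃ ++ X₁ ++ T    ↭⟨ prep c₁ (prep c₂ (prep c₃ middle)) ⟩
  c₁ ∷ c₂ ∷ c₃ ∷ X₁ ++ X₂ ++ X₃ ++ T    ↭⟨ ↭-sym (↭-gather₃ c₁ X₁ c₂ X₂ c₃ (X₃ ++ T)) ⟩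
  c₁ ∷ X₁ ++ c₂ ∷ X₂ ++ c₃ ∷ X₃ ++ T    ∎
  where
  open PermutationReasoning
  middle : X₂ ++ X₃ ++ X₁ ++ T ↭ X₁ ++ X₂ ++ X₃ ++ T
  middle = begin
    X₂ ++ X₃ ++ X₁ ++ T     ≡⟨ sym (++-assoc X₂ X₃ _) ⟩
    (X₂ ++ X₃) ++ X₁ ++ T   ↭⟨ shifts (X₂ ++ X₃) X₁ ⟩
    X₁ ++ (X₂ ++ X₃) ++ T   ≡⟨ cong (X₁ ++_) (++-assoc X₂ X₃ T) ⟩
    X₁ ++ X₂ ++ X₃ ++ T     ∎

↭-swap-pieces₂ : ∀ c₁ (X₁ : List ℕ) c₂ X₂ c₃ X₃ T →
                 (c₁ ∷ X₂ ++ c₃ ∷ X₁ ++ c₂ ∷ X₃) ++ T ↭ (c₁ ∷ X₁ ++ c₂ ∷ X₂ ++ c₃ ∷ X₃) ++ T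
↭-swap-pieces₂ c₁ X₁ c₂ X₂ c₃ X₃ T = begin
  c₁ ∷ (X₂ ++ c₃ ∷ X₁ ++ c₂ ∷ X₃) ++ T  ≡⟨ cong (c₁ ∷_) (++-assoc₃ X₂ c₃ X₁ c₂ X₃ T) ⟩
  c₁ ∷ X₂ ++ c₃ ∷ X₁ ++ c₂ ∷ X₃ ++ T    ↭⟨ ↭-gather₃ c₁ X₂ c₃ X₁ c₂ (X₃ ++ T) ⟩
  c₁ ∷ c₃ ∷ c₂ ∷ X₂ ++ X₁ ++ X₃ ++ T    ↭⟨ prep c₁ (swap c₃ c₂ (shifts X₂ X₁)) ⟩
  c₁ ∷ c₂ ∷ c₃ ∷ X₁ ++ X₂ ++ X₃ ++ T    ↭⟨ ↭-sym (↭-gather₃ c₁ X₁ c₂ X₂ c₃ (X₃ ++ T)) ⟩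
  c₁ ∷ X₁ ++ c₂ ∷ X₂ ++ c₃ ∷ X₃ ++ T    ≡⟨ cong (c₁ ∷_) (sym (++-assoc₃ X₁ c₂ X₂ c₃ X₃ T)) ⟩
  c₁ ∷ (X₁ ++ c₂ ∷ X₂ ++ c₃ ∷ X₃) ++ T  ∎
  where open PermutationReasoning

∈-∃++-ordered : ∀ {a b : ℕ} {T} → a ∈ T → b ∈ T → a ≢ b →
                (∃₂ λ A B → ∃ λ C → T ≡ A ++ a ∷ B ++ b ∷ C) ⊎ (∃₂ λ A B → ∃ λ C → T ≡ A ++ b ∷ B ++ a ∷ C)
∈-∃++-ordered a∈ b∈ a≢b with ∈-∃++ a∈
... | A , T′ , refl with ∈-++⁻ A b∈
... | inj₂ (here refl) = ⊥-elim (a≢b refl)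
... | inj₂ (there b∈T′) with ∈-∃++ b∈T′
...   | B , C , refl = inj₁ (A , B , C , refl)
∈-∃++-ordered {a} {b} a∈ b∈ a≢b | A , T′ , refl | inj₁ b∈A with ∈-∃++ b∈A
...   | A₁ , A₂ , refl = inj₂ (A₁ , A₂ , T′ , ++-assoc A₁ (b ∷ A₂) (a ∷ T′))

length-pieces₃ : ∀ a (X₁ : List ℕ) b X₂ c X₃ →
                 length (a ∷ X₁ ++ b ∷ X₂ ++ c ∷ X₃) ≡ length (a ∷ X₁) + length (b ∷ X₂) + length (c ∷ X₃)
length-pieces₃ a X₁ b X₂ c X₃ =
  trans (cong suc (trans (length-++ X₁) (cong (λ w → length X₁ + suc w) (length-++ X₂))))
          (arith (length X₁) (length X₂) (length X₃))
  where
  arith : ∀ x y z → suc (x + suc (y + suc z)) ≡ suc x + suc y + suc z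
  arith = solve-∀

record InverseBelow (n : ℕ) (f g : ℕ → ℕ) : Set where
  field
    f< : ∀ {x} → x < n → f x < n
    g< : ∀ {x} → x < n → g x < n
    g∘f : ∀ {x} → x < n → g (f x) ≡ x
    f∘g : ∀ {x} → x < n → f (g x) ≡ x
open InverseBelow public

InverseBelow-sym : ∀ {n f g} → InverseBelow n f g → InverseBelow n g f
InverseBelow-sym B = record { f< = g< B ; g< = f< B ; g∘f = f∘g B ; f∘g = g∘f B }

InverseBelow-∘ : ∀ {n f g h k} → InverseBelow n f g → InverseBelow n h k →
                 InverseBelow n (λ x → f (h x)) (λ x → k (g x))
InverseBelow-∘ {f = f} {k = k} B C = record
  { f< = λ x< → f< B (f< C x<)
  ; g< = λ x< → g< C (g< B x<)
  ; g∘f = λ x< → trans (cong k (g∘f B (f< C x<))) (g∘f C x<)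
  ; f∘g = λ x< → trans (cong f (f∘g C (g< B x<))) (f∘g B x<) }

InverseBelow-injective : ∀ {n f g} → InverseBelow n f g → ∀ {x y} → x < n → y < n → f x ≡ f y → x ≡ y
InverseBelow-injective {g = g} B x< y< e = trans (sym (g∘f B x<)) (trans (cong g e) (g∘f B y<))

-- Case splits go through ≡⊎≢ rather than _≟_: a with-abstraction over _≟_ would also abstract
-- the test inside _[_↦_] below.
≡⊎≢ : (x y : ℕ) → x ≡ y ⊎ x ≢ y
≡⊎≢ x y with x ≟ y
... | yes x≡y = inj₁ x≡y
... | no x≢y = inj₂ x≢y

map-InverseBelow-↭ : ∀ {n f g L} → L ↭ downFrom n → InverseBelow n f g → map f L ↭ downFrom n
map-InverseBelow-↭ {n} {f} {g} {L} L↭ B =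
  unique∧sameMembers⇒↭ (Unique-map⁺-on f injective (Unique-↭downFrom L↭)) (downFrom⁺ n) to from
  where
  injective : ∀ {x y} → x ∈ L → y ∈ L → f x ≡ f y → x ≡ y
  injective x∈ y∈ = InverseBelow-injective B (∈-↭downFrom⁻ L↭ x∈) (∈-↭downFrom⁻ L↭ y∈)
  to : ∀ {z} → z ∈ map f L → z ∈ downFrom n
  to z∈ with ∈-map⁻ f z∈
  ... | x , x∈ , refl = ∈-downFrom⁺ (f< B (∈-↭downFrom⁻ L↭ x∈))
  from : ∀ {z} → z ∈ downFrom n → z ∈ map f L
  from {z} z∈ = subst (_∈ map f L) (f∘g B z<) (∈-map⁺ f (∈-resp-↭ (↭-sym L↭) (∈-downFrom⁺ (g< B z<))))
    where z< = ∈-downFrom⁻ z∈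

_[_↦_] : (ℕ → ℕ) → ℕ → ℕ → ℕ → ℕ
(f [ k ↦ v ]) x with x ≟ k
... | yes _ = v
... | no _ = f x

[↦]-≡ : ∀ f k v → (f [ k ↦ v ]) k ≡ v
[↦]-≡ f k v with k ≟ k
... | yes _ = refl
... | no k≢k = ⊥-elim (k≢k refl)

[↦]-≢ : ∀ {f k v x} → x ≢ k → (f [ k ↦ v ]) x ≡ f x
[↦]-≢ {k = k} {x = x} x≢k with x ≟ k
... | yes x≡k = ⊥-elim (x≢k x≡k)
... | no _ = refl

extend : ℕ → (ℕ → ℕ) → ℕ → ℕ
extend n f = f [ n ↦ n ]

extend-InverseBelow : ∀ {n f g} → InverseBelow n f g → InverseBelow (suc n) (extend n f) (extend n g)
extend-InverseBelow {n} {f} {g} B = record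
  { f< = ext< (f< B) ; g< = ext< (g< B) ; g∘f = ext-inv (f< B) (g∘f B) ; f∘g = ext-inv (g< B) (f∘g B) }
  where
  ext< : ∀ {h} → (∀ {x} → x < n → h x < n) → ∀ {x} → x < suc n → extend n h x < suc n
  ext< h< {x} x< with m<1+n⇒m<n∨m≡n x<
  ... | inj₁ x<n = subst (_< suc n) (sym ([↦]-≢ (<⇒≢ x<n))) (m<n⇒m<1+n (h< x<n))
  ... | inj₂ refl = subst (_< suc n) (sym ([↦]-≡ _ n n)) (n<1+n n)
  ext-inv : ∀ {h k} → (∀ {x} → x < n → h x < n) → (∀ {x} → x < n → k (h x) ≡ x) →
            ∀ {x} → x < suc n → extend n k (extend n h x) ≡ x
  ext-inv {h} {k} h< k∘h {x} x< with m<1+n⇒m<n∨m≡n x<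
  ... | inj₁ x<n = trans (cong (extend n k) ([↦]-≢ (<⇒≢ x<n))) (trans ([↦]-≢ (<⇒≢ (h< x<n))) (k∘h x<n))
  ... | inj₂ refl = trans (cong (extend n k) ([↦]-≡ h n n)) ([↦]-≡ k n n)

insertAfter : ℕ → ℕ → (ℕ → ℕ) → ℕ → ℕ
insertAfter y n f = (f [ n ↦ f y ]) [ y ↦ n ]

insertAfter⁻¹ : ℕ → ℕ → (ℕ → ℕ) → (ℕ → ℕ) → ℕ → ℕ
insertAfter⁻¹ y n f g = (g [ f y ↦ n ]) [ n ↦ y ]

insertAfter-at : ∀ y n f → insertAfter y n f y ≡ n
insertAfter-at y n f = [↦]-≡ _ y n

insertAfter-new : ∀ {y n f} → n ≢ y → insertAfter y n f n ≡ f y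
insertAfter-new {y} {n} {f} n≢y = trans ([↦]-≢ n≢y) ([↦]-≡ f n (f y))

insertAfter-other : ∀ {y n f x} → x ≢ y → x ≢ n → insertAfter y n f x ≡ f x
insertAfter-other x≢y x≢n = trans ([↦]-≢ x≢y) ([↦]-≢ x≢n)

insertAfter-InverseBelow : ∀ {n f g y} → InverseBelow n f g → y < n →
                           InverseBelow (suc n) (insertAfter y n f) (insertAfter⁻¹ y n f g)
insertAfter-InverseBelow {n} {f} {g} {y} B y< = record { f< = ins< ; g< = ins⁻¹< ; g∘f = ins⁻¹∘ins ; f∘g = ins∘ins⁻¹ }
  where
  ins = insertAfter y n f
  ins⁻¹ = insertAfter⁻¹ y n f g
  n≢y : n ≢ y
  n≢y = >⇒≢ y<
  fy< : f y < n
  fy< = f< B y<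
  ins⁻¹-new : ins⁻¹ n ≡ y
  ins⁻¹-new = [↦]-≡ _ n y
  ins⁻¹-fy : ins⁻¹ (f y) ≡ n
  ins⁻¹-fy = trans ([↦]-≢ (<⇒≢ fy<)) ([↦]-≡ g (f y) n)
  ins⁻¹-other : ∀ {x} → x ≢ n → x ≢ f y → ins⁻¹ x ≡ g x
  ins⁻¹-other x≢n x≢fy = trans ([↦]-≢ x≢n) ([↦]-≢ x≢fy)
  ins< : ∀ {x} → x < suc n → ins x < suc n
  ins< {x} x< with ≡⊎≢ x y | m<1+n⇒m<n∨m≡n x<
  ... | inj₁ refl | _ = subst (_< suc n) (sym (insertAfter-at y n f)) (n<1+n n)
  ... | inj₂ _ | inj₂ refl = subst (_< suc n) (sym (insertAfter-new n≢y)) (m<n⇒m<1+n fy<)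
  ... | inj₂ x≢y | inj₁ x<n = subst (_< suc n) (sym (insertAfter-other x≢y (<⇒≢ x<n))) (m<n⇒m<1+n (f< B x<n))
  ins⁻¹< : ∀ {x} → x < suc n → ins⁻¹ x < suc n
  ins⁻¹< {x} x< with ≡⊎≢ x (f y) | m<1+n⇒m<n∨m≡n x<
  ... | _ | inj₂ refl = subst (_< suc n) (sym ins⁻¹-new) (m<n⇒m<1+n y<)
  ... | inj₁ refl | inj₁ _ = subst (_< suc n) (sym ins⁻¹-fy) (n<1+n n)
  ... | inj₂ x≢fy | inj₁ x<n = subst (_< suc n) (sym (ins⁻¹-other (<⇒≢ x<n) x≢fy)) (m<n⇒m<1+n (g< B x<n))
  ins⁻¹∘ins : ∀ {x} → x < suc n → ins⁻¹ (ins x) ≡ x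
  ins⁻¹∘ins {x} x< with ≡⊎≢ x y | m<1+n⇒m<n∨m≡n x<
  ... | inj₁ refl | _ = trans (cong ins⁻¹ (insertAfter-at y n f)) ins⁻¹-new
  ... | inj₂ _ | inj₂ refl = trans (cong ins⁻¹ (insertAfter-new n≢y)) ins⁻¹-fy
  ... | inj₂ x≢y | inj₁ x<n =
    trans (cong ins⁻¹ (insertAfter-other x≢y (<⇒≢ x<n)))
          (trans (ins⁻¹-other (<⇒≢ (f< B x<n)) (λ e → x≢y (InverseBelow-injective B x<n y< e))) (g∘f B x<n))
  ins∘ins⁻¹ : ∀ {x} → x < suc n → ins (ins⁻¹ x) ≡ x
  ins∘ins⁻¹ {x} x< with ≡⊎≢ x (f y) | m<1+n⇒m<n∨m≡n x<
  ... | _ | inj₂ refl = trans (cong ins ins⁻¹-new) (insertAfter-at y n f)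
  ... | inj₁ refl | inj₁ _ = trans (cong ins ins⁻¹-fy) (insertAfter-new n≢y)
  ... | inj₂ x≢fy | inj₁ x<n =
    trans (cong ins (ins⁻¹-other (<⇒≢ x<n) x≢fy))
          (trans (insertAfter-other (λ e → x≢fy (trans (sym (f∘g B x<n)) (cong f e))) (<⇒≢ (g< B x<n))) (f∘g B x<n))

extend∘insertAfter-new : ∀ {n σ σ⁻¹ α y} → InverseBelow n σ σ⁻¹ → y < n → extend n α (insertAfter y n σ n) ≡ α (σ y)
extend∘insertAfter-new {n} {σ} {α = α} B y< = trans (cong (extend n α) (insertAfter-new (>⇒≢ y<))) ([↦]-≢ (<⇒≢ (f< B y<)))

extend∘insertAfter-other : ∀ {n σ σ⁻¹ α y x} → InverseBelow n σ σ⁻¹ → x < n → x ≢ y →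
                           extend n α (insertAfter y n σ x) ≡ α (σ x)
extend∘insertAfter-other {n} {σ} {α = α} B x< x≢y =
  trans (cong (extend n α) (insertAfter-other x≢y (<⇒≢ x<))) ([↦]-≢ (<⇒≢ (f< B x<)))

insertAfter²-new : ∀ {n σ α y z} → y < n → σ y ≡ z → insertAfter z n α (insertAfter y n σ n) ≡ n
insertAfter²-new {n} {α = α} {z = z} y< σy≡z = trans (cong (insertAfter z n α) (trans (insertAfter-new (>⇒≢ y<)) σy≡z)) (insertAfter-at z n α)

insertAfter²-old : ∀ {n σ σ⁻¹ α y z x} → InverseBelow n σ σ⁻¹ → y < n → z < n → σ y ≡ z → x < n →
                   insertAfter z n α (insertAfter y n σ x) ≡ α (σ x)
insertAfter²-old {n} {σ} {α = α} {y} {z} {x} B y< z< σy≡z x< with ≡⊎≢ x y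
... | inj₁ refl = trans (cong (insertAfter z n α) (insertAfter-at y n σ)) (trans (insertAfter-new (>⇒≢ z<)) (cong α (sym σy≡z)))
... | inj₂ x≢y = trans (cong (insertAfter z n α) (insertAfter-other x≢y (<⇒≢ x<)))
                       (insertAfter-other (λ e → x≢y (InverseBelow-injective B x< y< (trans e (sym σy≡z)))) (<⇒≢ (f< B x<)))

record Distinct3 (a b c : ℕ) : Set where
  constructor distinct3
  field
    a≢b : a ≢ b
    a≢c : a ≢ c
    b≢c : b ≢ c

Distinct3-reverse : ∀ {a b c} → Distinct3 a b c → Distinct3 c b a
Distinct3-reverse (distinct3 a≢b a≢c b≢c) = distinct3 (λ e → b≢c (sym e)) (λ e → a≢c (sym e)) (λ e → a≢b (sym e))

rotate3 : ℕ → ℕ → ℕ → ℕ → ℕ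
rotate3 a b c = (((λ x → x) [ c ↦ a ]) [ b ↦ c ]) [ a ↦ b ]

module Rotate3 {a b c : ℕ} (d : Distinct3 a b c) where
  open Distinct3 d

  at-a : rotate3 a b c a ≡ b
  at-a = [↦]-≡ _ a b

  at-b : rotate3 a b c b ≡ c
  at-b = trans ([↦]-≢ (λ e → a≢b (sym e))) ([↦]-≡ _ b c)

  at-c : rotate3 a b c c ≡ a
  at-c = trans ([↦]-≢ (λ e → a≢c (sym e))) (trans ([↦]-≢ (λ e → b≢c (sym e))) ([↦]-≡ _ c a))

  at-other : ∀ {x} → x ≢ a → x ≢ b → x ≢ c → rotate3 a b c x ≡ x
  at-other x≢a x≢b x≢c = trans ([↦]-≢ x≢a) (trans ([↦]-≢ x≢b) ([↦]-≢ x≢c))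

  data Position (x : ℕ) : Set where
    is-a : x ≡ a → Position x
    is-b : x ≡ b → Position x
    is-c : x ≡ c → Position x
    other : x ≢ a → x ≢ b → x ≢ c → Position x

  position : ∀ x → Position x
  position x with ≡⊎≢ x a | ≡⊎≢ x b | ≡⊎≢ x c
  ... | inj₁ x≡a | _ | _ = is-a x≡a
  ... | inj₂ _ | inj₁ x≡b | _ = is-b x≡b
  ... | inj₂ _ | inj₂ _ | inj₁ x≡c = is-c x≡c
  ... | inj₂ x≢a | inj₂ x≢b | inj₂ x≢c = other x≢a x≢b x≢c

rotate3-InverseBelow : ∀ {n a b c} → Distinct3 a b c → a < n → b < n → c < n →
                       InverseBelow n (rotate3 a b c) (rotate3 c b a)
rotate3-InverseBelow {n} {a} {b} {c} d a< b< c< = record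
  { f< = τ< ; g< = τ⁻¹< ; g∘f = λ {x} _ → τ⁻¹∘τ x ; f∘g = λ {x} _ → τ∘τ⁻¹ x }
  where
  open Rotate3 d
  module Inv = Rotate3 (Distinct3-reverse d)
  τ = rotate3 a b c
  τ⁻¹ = rotate3 c b a
  τ< : ∀ {x} → x < n → τ x < n
  τ< {x} x< with position x
  ... | is-a refl = subst (_< n) (sym at-a) b<
  ... | is-b refl = subst (_< n) (sym at-b) c<
  ... | is-c refl = subst (_< n) (sym at-c) a<
  ... | other x≢a x≢b x≢c = subst (_< n) (sym (at-other x≢a x≢b x≢c)) x<
  τ⁻¹< : ∀ {x} → x < n → τ⁻¹ x < n
  τ⁻¹< {x} x< with position x
  ... | is-a refl = subst (_< n) (sym Inv.at-c) c<
  ... | is-b refl = subst (_< n) (sym Inv.at-b) a<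
  ... | is-c refl = subst (_< n) (sym Inv.at-a) b<
  ... | other x≢a x≢b x≢c = subst (_< n) (sym (Inv.at-other x≢c x≢b x≢a)) x<
  τ⁻¹∘τ : ∀ x → τ⁻¹ (τ x) ≡ x
  τ⁻¹∘τ x with position x
  ... | is-a refl = trans (cong τ⁻¹ at-a) Inv.at-b
  ... | is-b refl = trans (cong τ⁻¹ at-b) Inv.at-a
  ... | is-c refl = trans (cong τ⁻¹ at-c) Inv.at-c
  ... | other x≢a x≢b x≢c = trans (cong τ⁻¹ (at-other x≢a x≢b x≢c)) (Inv.at-other x≢c x≢b x≢a)
  τ∘τ⁻¹ : ∀ x → τ (τ⁻¹ x) ≡ x
  τ∘τ⁻¹ x with position x
  ... | is-a refl = trans (cong τ Inv.at-c) at-c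
  ... | is-b refl = trans (cong τ Inv.at-b) at-a
  ... | is-c refl = trans (cong τ Inv.at-a) at-b
  ... | other x≢a x≢b x≢c = trans (cong τ (Inv.at-other x≢c x≢b x≢a)) (at-other x≢a x≢b x≢c)

restrict : ∀ {n} (f : ℕ → ℕ) → (∀ {x} → x < n → f x < n) → Fin n → Fin n
restrict f f< i = fromℕ< (f< (toℕ<n i))

toPermutation : ∀ {n f g} → InverseBelow n f g → Permutation′ n
toPermutation {f = f} {g} B = permutation (restrict f (f< B)) (restrict g (g< B)) f∘g′ g∘f′
  where
  f∘g′ : ∀ i → restrict f (f< B) (restrict g (g< B) i) ≡ i
  f∘g′ i = toℕ-injective (trans (toℕ-fromℕ< _) (trans (cong f (toℕ-fromℕ< _)) (f∘g B (toℕ<n i))))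
  g∘f′ : ∀ i → restrict g (g< B) (restrict f (f< B) i) ≡ i
  g∘f′ i = toℕ-injective (trans (toℕ-fromℕ< _) (trans (cong g (toℕ-fromℕ< _)) (g∘f B (toℕ<n i))))

toℕ-toPermutation : ∀ {n f g} (B : InverseBelow n f g) i → toℕ (toPermutation B ⟨$⟩ʳ i) ≡ f (toℕ i)
toℕ-toPermutation B i = toℕ-fromℕ< _

toℕ-iter : ∀ {n f g} (B : InverseBelow n f g) k i → toℕ (iter (toPermutation B) k i) ≡ iterate f k (toℕ i)
toℕ-iter B zero i = refl
toℕ-iter {f = f} B (suc k) i = trans (toℕ-toPermutation B _) (cong f (toℕ-iter B k i))

module _ {A B : Set} where

  zip-∈ˡ : ∀ (xs : List A) (ys : List B) → length xs ≡ length ys → ∀ {x} → x ∈ xs → ∃ λ y → (x , y) ∈ zip xs ys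
  zip-∈ˡ (x ∷ xs) (y ∷ ys) _ (here refl) = y , here refl
  zip-∈ˡ (x ∷ xs) (y ∷ ys) e (there x∈) with zip-∈ˡ xs ys (cong pred e) x∈
  ... | y′ , p∈ = y′ , there p∈

  zip-∈ʳ : ∀ (xs : List A) (ys : List B) → length xs ≡ length ys → ∀ {y} → y ∈ ys → ∃ λ x → (x , y) ∈ zip xs ys
  zip-∈ʳ (x ∷ xs) (y ∷ ys) _ (here refl) = x , here refl
  zip-∈ʳ (x ∷ xs) (y ∷ ys) e (there y∈) with zip-∈ʳ xs ys (cong pred e) y∈
  ... | x′ , p∈ = x′ , there p∈

  zip-∈⁻ˡ : ∀ {xs : List A} {ys : List B} {x y} → (x , y) ∈ zip xs ys → x ∈ xs
  zip-∈⁻ˡ {x ∷ xs} {y ∷ ys} (here refl) = here refl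
  zip-∈⁻ˡ {x ∷ xs} {y ∷ ys} (there p∈) = there (zip-∈⁻ˡ p∈)

  zip-∈⁻ʳ : ∀ {xs : List A} {ys : List B} {x y} → (x , y) ∈ zip xs ys → y ∈ ys
  zip-∈⁻ʳ {x ∷ xs} {y ∷ ys} (here refl) = here refl
  zip-∈⁻ʳ {x ∷ xs} {y ∷ ys} (there p∈) = there (zip-∈⁻ʳ p∈)

  zip-map-≡ : ∀ (f : A → ℕ) (g : B → ℕ) {xs ys} → map f xs ≡ map g ys → ∀ {x y} → (x , y) ∈ zip xs ys → f x ≡ g y
  zip-map-≡ f g {x ∷ xs} {y ∷ ys} e (here refl) = ∷-injectiveˡ e
  zip-map-≡ f g {x ∷ xs} {y ∷ ys} e (there p∈) = zip-map-≡ f g (∷-injectiveʳ e) p∈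

  zip-functional : ∀ {xs : List A} {ys : List B} → Unique xs → ∀ {x y y′} →
                   (x , y) ∈ zip xs ys → (x , y′) ∈ zip xs ys → y ≡ y′
  zip-functional {x ∷ xs} {y ∷ ys} _ (here refl) (here refl) = refl
  zip-functional {x ∷ xs} {y ∷ ys} u (here refl) (there p∈) = ⊥-elim (Unique[x∷xs]⇒x∉xs u (zip-∈⁻ˡ p∈))
  zip-functional {x ∷ xs} {y ∷ ys} u (there p∈) (here refl) = ⊥-elim (Unique[x∷xs]⇒x∉xs u (zip-∈⁻ˡ p∈))
  zip-functional {x ∷ xs} {y ∷ ys} (_ ∷ u) (there p∈) (there p∈′) = zip-functional u p∈ p∈′

zip-disjoint : ∀ {A : Set} {xs : List A} {Cs : List (List ℕ)} → Unique (concat Cs) → ∀ {x x′ C C′ z} →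
               (x , C) ∈ zip xs Cs → (x′ , C′) ∈ zip xs Cs → z ∈ C → z ∈ C′ → x ≡ x′
zip-disjoint {xs = x ∷ xs} {C ∷ Cs} u (here refl) (here refl) _ _ = refl
zip-disjoint {xs = x ∷ xs} {C ∷ Cs} u (here refl) (there p∈) z∈ z∈′ =
  ⊥-elim (Unique-++-disjoint C u z∈ (∈-concat⁺′ z∈′ (zip-∈⁻ʳ p∈)))
zip-disjoint {xs = x ∷ xs} {C ∷ Cs} u (there p∈) (here refl) z∈ z∈′ =
  ⊥-elim (Unique-++-disjoint C u z∈′ (∈-concat⁺′ z∈ (zip-∈⁻ʳ p∈)))
zip-disjoint {xs = x ∷ xs} {C ∷ Cs} u (there p∈) (there p∈′) z∈ z∈′ = zip-disjoint (Unique-++⁻ʳ C u) p∈ p∈′ z∈ z∈′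

map-const-tabulate : ∀ {A B : Set} {k} (f : Fin k → A) (v : B) → map (λ _ → v) (tabulate f) ≡ replicate k v
map-const-tabulate {k = zero} f v = refl
map-const-tabulate {k = suc k} f v = cong (v ∷_) (map-const-tabulate (λ i → f (Fin.suc i)) v)

sucSlot : ∀ {k} {m : Fin (suc k) → ℕ} → Σ (Fin k) (λ s → Fin (m (Fin.suc s))) → Σ (Fin (suc k)) (λ s → Fin (m s))
sucSlot (s , i) = Fin.suc s , i

slots : ∀ {k} (m : Fin k → ℕ) → List (Σ (Fin k) (λ s → Fin (m s)))
slots {zero} m = []
slots {suc k} m = map (Fin.zero ,_) (allFin (m Fin.zero)) ++ map sucSlot (slots (λ s → m (Fin.suc s)))

∈-slots : ∀ {k} (m : Fin k → ℕ) p → p ∈ slots m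
∈-slots {suc k} m (Fin.zero , i) = ∈-++⁺ˡ (∈-map⁺ (Fin.zero ,_) (∈-allFin i))
∈-slots {suc k} m (Fin.suc s , i) = ∈-++⁺ʳ _ (∈-map⁺ sucSlot (∈-slots (λ s → m (Fin.suc s)) (s , i)))

slots-unique : ∀ {k} (m : Fin k → ℕ) → Unique (slots m)
slots-unique {zero} m = []
slots-unique {suc k} m =
  Unique.++⁺ (Unique.map⁺ (λ { refl → refl }) (allFin⁺ _))
             (Unique.map⁺ (λ { {_ , _} {_ , _} refl → refl }) (slots-unique (λ s → m (Fin.suc s))))
             disjoint
  where
  disjoint : ∀ {p} → p ∈ map (Fin.zero ,_) (allFin (m Fin.zero)) × p ∈ map sucSlot (slots (λ s → m (Fin.suc s))) → ⊥
  disjoint (p∈₁ , p∈₂) with ∈-map⁻ (Fin.zero ,_) p∈₁ | ∈-map⁻ sucSlot p∈₂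
  ... | _ , _ , refl | _ , _ , ()

map-weight-slots : ∀ {k} (m w : Fin k → ℕ) → map (λ p → w (proj₁ p)) (slots m) ≡ weightsFrom m w
map-weight-slots {zero} m w = refl
map-weight-slots {suc k} m w =
  trans (map-++ _ (map (Fin.zero ,_) (allFin (m Fin.zero))) _)
    (cong₂ _++_ (trans (sym (map-∘ (allFin (m Fin.zero)))) (map-const-tabulate (λ i → i) (w Fin.zero)))
                (trans (sym (map-∘ (slots (λ s → m (Fin.suc s))))) (map-weight-slots (λ s → m (Fin.suc s)) (λ s → w (Fin.suc s)))))

cycleHead : ∀ {f} C → Cycle f C → ℕ
cycleHead (c ∷ _) _ = c

cycleHead-∈ : ∀ {f} C (cy : Cycle f C) → cycleHead C cy ∈ C
cycleHead-∈ (c ∷ _) _ = here refl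

module Labeling {n f g} (B : InverseBelow n f g) where

  π : Permutation′ n
  π = toPermutation B

  iterate-fromℕ< : ∀ {c} (c< : c < n) k → toℕ (iter π k (fromℕ< c<)) ≡ iterate f k c
  iterate-fromℕ< c< k = trans (toℕ-iter B k (fromℕ< c<)) (cong (iterate f k) (toℕ-fromℕ< c<))

  cycle-length : ∀ C (cy : Cycle f C) → Unique C → (h< : cycleHead C cy < n) → CycleLength π (fromℕ< h<) (length C)
  cycle-length (c ∷ L) cy u h< = s≤s z≤n , closes , not-before
    where
    closes : iter π (suc (length L)) (fromℕ< h<) ≡ fromℕ< h<
    closes = toℕ-injective (trans (iterate-fromℕ< h< (suc (length L))) (trans (Chain-iterate-end L cy) (sym (toℕ-fromℕ< h<))))
    not-before : ∀ j → 1 ≤ j → j < suc (length L) → iter π j (fromℕ< h<) ≢ fromℕ< h<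
    not-before j 1≤j j< e = Unique[x∷xs]⇒x∉xs u (subst (_∈ L) back (Chain-iterate-∈ L cy j 1≤j (≤-pred j<)))
      where
      back : iterate f j c ≡ c
      back = trans (sym (iterate-fromℕ< h< j)) (trans (cong toℕ e) (toℕ-fromℕ< h<))

  ∈⇒InOrbit : ∀ C (cy : Cycle f C) (h< : cycleHead C cy < n) y → toℕ y ∈ C → InOrbit π (fromℕ< h<) y
  ∈⇒InOrbit (c ∷ L) cy h< y y∈ with Chain-reaches L cy y∈
  ... | k , e = k , toℕ-injective (trans (iterate-fromℕ< h< k) e)

  InOrbit⇒∈ : ∀ C (cy : Cycle f C) (h< : cycleHead C cy < n) y → InOrbit π (fromℕ< h<) y → toℕ y ∈ C
  InOrbit⇒∈ (c ∷ L) cy h< y (k , e) =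
    subst (_∈ c ∷ L) (trans (sym (iterate-fromℕ< h< k)) (cong toℕ e)) (Cycle-iterate-∈ (c ∷ L) cy (here refl) k)

  -- A slot is labelled by the cycle standing at its own position in slots (mult Π).
  labeling : ∀ Cs → All (Cycle f) Cs → concat Cs ↭ downFrom n → (Π : Datum) → map length Cs ≡ weights Π →
             CycleLabeling π Π
  labeling Cs cycles covers Π eq = record { rep = rep ; len = len ; unique = unique }
    where
    SL = slots (mult Π)
    weights≡ : map (λ p → wt Π (proj₁ p)) SL ≡ map length Cs
    weights≡ = trans (map-weight-slots (mult Π) (wt Π)) (sym eq)
    |SL|≡|Cs| : length SL ≡ length Cs
    |SL|≡|Cs| = trans (sym (length-map _ SL)) (trans (cong length weights≡) (length-map length Cs))
    partner : ∀ p → ∃ λ C → (p , C) ∈ zip SL Cs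
    partner p = zip-∈ˡ SL Cs |SL|≡|Cs| (∈-slots (mult Π) p)
    cycleOf : Slot Π → List ℕ
    cycleOf p = proj₁ (partner p)
    cycleOf-∈ : ∀ p → cycleOf p ∈ Cs
    cycleOf-∈ p = zip-∈⁻ʳ (proj₂ (partner p))
    isCycle : ∀ p → Cycle f (cycleOf p)
    isCycle p = All.lookup cycles (cycleOf-∈ p)
    head< : ∀ p → cycleHead (cycleOf p) (isCycle p) < n
    head< p = ∈-↭downFrom⁻ covers (∈-concat⁺′ (cycleHead-∈ (cycleOf p) (isCycle p)) (cycleOf-∈ p))
    rep : Slot Π → Fin n
    rep p = fromℕ< (head< p)
    len : ∀ p → CycleLength π (rep p) (wt Π (proj₁ p))
    len p = subst (CycleLength π (rep p)) (sym (zip-map-≡ _ length weights≡ (proj₂ (partner p))))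
              (cycle-length (cycleOf p) (isCycle p) (Unique-concat⁻ (Unique-↭downFrom covers) (cycleOf-∈ p)) (head< p))
    unique : ∀ y → ∃ λ p → InOrbit π (rep p) y × (∀ q → InOrbit π (rep q) y → q ≡ p)
    unique y with ∈-concat⁻′ Cs (∈-resp-↭ (↭-sym covers) (∈-downFrom⁺ (toℕ<n y)))
    ... | C , y∈C , C∈ with zip-∈ʳ SL Cs |SL|≡|Cs| C∈
    ... | p , paired =
      p , ∈⇒InOrbit (cycleOf p) (isCycle p) (head< p) y y∈cycleOf ,
      λ q orbit → zip-disjoint (Unique-↭downFrom covers) (proj₂ (partner q)) (proj₂ (partner p))
                    (InOrbit⇒∈ (cycleOf q) (isCycle q) (head< q) y orbit) y∈cycleOf
      where
      y∈cycleOf : toℕ y ∈ cycleOf p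
      y∈cycleOf = subst (toℕ y ∈_) (zip-functional (slots-unique (mult Π)) paired (proj₂ (partner p))) y∈C

record DartPermutations (n : ℕ) : Set where
  field
    σ σ⁻¹ α α⁻¹ : ℕ → ℕ
    σ-inverse : InverseBelow n σ σ⁻¹
    α-inverse : InverseBelow n α α⁻¹

-- The face permutation of the final hypermap is the inverse of α ∘ σ, so F is its one large face
-- read backwards and D lists its fixed points. The two meets-face conditions make the map connected
-- and are exchanged by swapColours.
record QuasiOneFaceMap (n : ℕ) (Bs Ws : List (List ℕ)) (F D : List ℕ) : Set where
  field
    perms : DartPermutations n
  open DartPermutations perms public
  field
    σ-cycles : All (Cycle σ) Bs
    α-cycles : All (Cycle α) Ws
    face-cycle : Cycle (λ x → α (σ x)) F
    face-fixed : All (λ d → α (σ d) ≡ d) D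
    σ-covers : concat Bs ↭ downFrom n
    α-covers : concat Ws ↭ downFrom n
    face-covers : F ++ D ↭ downFrom n
    σ-meets-face : All (Any (_∈ F)) Bs
    α-meets-face : All (λ C → ∃ λ u → u ∈ F × σ u ∈ C) Ws

singleEdge : QuasiOneFaceMap 1 ([ 0 ] ∷ []) ([ 0 ] ∷ []) [ 0 ] []
singleEdge = record
  { perms = record { σ = λ x → x ; σ⁻¹ = λ x → x ; α = λ x → x ; α⁻¹ = λ x → x ; σ-inverse = identity ; α-inverse = identity }
  ; σ-cycles = refl ∷ [] ; α-cycles = refl ∷ [] ; face-cycle = refl ; face-fixed = []
  ; σ-covers = ↭-refl ; α-covers = ↭-refl ; face-covers = ↭-refl
  ; σ-meets-face = here (here refl) ∷ []
  ; α-meets-face = (0 , here refl , here refl) ∷ []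
  }
  where
  identity : InverseBelow 1 (λ x → x) (λ x → x)
  identity = record { f< = λ x< → x< ; g< = λ x< → x< ; g∘f = λ _ → refl ; f∘g = λ _ → refl }

module _ {n : ℕ} where

  reorderBlack : ∀ {Bs Bs′ Ws F D} → Bs ↭ Bs′ → QuasiOneFaceMap n Bs Ws F D → QuasiOneFaceMap n Bs′ Ws F D
  reorderBlack p M = record
    { perms = perms
    ; σ-cycles = All-resp-↭ p σ-cycles ; α-cycles = α-cycles ; face-cycle = face-cycle ; face-fixed = face-fixed
    ; σ-covers = ↭-trans (↭-concat (↭-sym p)) σ-covers ; α-covers = α-covers ; face-covers = face-covers
    ; σ-meets-face = All-resp-↭ p σ-meets-face ; α-meets-face = α-meets-face }
    where open QuasiOneFaceMap M

  rotateBlack : ∀ xs c ys {R Ws F D} → QuasiOneFaceMap n ((xs ++ c ∷ ys) ∷ R) Ws F D →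
                QuasiOneFaceMap n ((c ∷ ys ++ xs) ∷ R) Ws F D
  rotateBlack xs c ys {R} M = record
    { perms = perms
    ; σ-cycles = Cycle-rotate xs c ys (All.head σ-cycles) ∷ All.tail σ-cycles
    ; α-cycles = α-cycles ; face-cycle = face-cycle ; face-fixed = face-fixed
    ; σ-covers = ↭-trans (++⁺ʳ (concat R) (↭-sym (↭-rotate xs c ys))) σ-covers
    ; α-covers = α-covers ; face-covers = face-covers
    ; σ-meets-face = Any-resp-↭ (↭-rotate xs c ys) (All.head σ-meets-face) ∷ All.tail σ-meets-face
    ; α-meets-face = α-meets-face }
    where open QuasiOneFaceMap M

  rotateWhite : ∀ xs c ys {R Bs F D} → QuasiOneFaceMap n Bs ((xs ++ c ∷ ys) ∷ R) F D →
                QuasiOneFaceMap n Bs ((c ∷ ys ++ xs) ∷ R) F D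
  rotateWhite xs c ys {R} {F = F} M = record
    { perms = perms
    ; σ-cycles = σ-cycles
    ; α-cycles = Cycle-rotate xs c ys (All.head α-cycles) ∷ All.tail α-cycles
    ; face-cycle = face-cycle ; face-fixed = face-fixed
    ; σ-covers = σ-covers
    ; α-covers = ↭-trans (++⁺ʳ (concat R) (↭-sym (↭-rotate xs c ys))) α-covers
    ; face-covers = face-covers
    ; σ-meets-face = σ-meets-face
    ; α-meets-face = rotate (All.head α-meets-face) ∷ All.tail α-meets-face }
    where
    open QuasiOneFaceMap M
    rotate : (∃ λ u → u ∈ F × σ u ∈ xs ++ c ∷ ys) → ∃ λ u → u ∈ F × σ u ∈ c ∷ ys ++ xs
    rotate (u , u∈ , σu∈) = u , u∈ , ∈-resp-↭ (↭-rotate xs c ys) σu∈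

  rotateFace : ∀ xs c ys {Bs Ws D} → QuasiOneFaceMap n Bs Ws (xs ++ c ∷ ys) D →
               QuasiOneFaceMap n Bs Ws (c ∷ ys ++ xs) D
  rotateFace xs c ys {D = D} M = record
    { perms = perms
    ; σ-cycles = σ-cycles ; α-cycles = α-cycles
    ; face-cycle = Cycle-rotate xs c ys face-cycle ; face-fixed = face-fixed
    ; σ-covers = σ-covers ; α-covers = α-covers
    ; face-covers = ↭-trans (++⁺ʳ D (↭-sym (↭-rotate xs c ys))) face-covers
    ; σ-meets-face = All.map (Any.map (∈-resp-↭ (↭-rotate xs c ys))) σ-meets-face
    ; α-meets-face = All.map (λ (u , u∈ , σu∈) → u , ∈-resp-↭ (↭-rotate xs c ys) u∈ , σu∈) α-meets-face }
    where open QuasiOneFaceMap M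

  swapColours : ∀ {Bs Ws F D} (M : QuasiOneFaceMap n Bs Ws F D) →
                QuasiOneFaceMap n Ws Bs (map (QuasiOneFaceMap.σ M) F) (map (QuasiOneFaceMap.σ M) D)
  swapColours {Bs} {Ws} {F} {D} M = record
    { perms = record { σ = α ; σ⁻¹ = α⁻¹ ; α = σ ; α⁻¹ = σ⁻¹ ; σ-inverse = α-inverse ; α-inverse = σ-inverse }
    ; σ-cycles = α-cycles ; α-cycles = σ-cycles
    ; face-cycle = mapped-face F face-cycle
    ; face-fixed = map⁺ (All.map (cong σ) face-fixed)
    ; σ-covers = α-covers ; α-covers = σ-covers
    ; face-covers = subst (_↭ downFrom n) (map-++ σ F D) (map-InverseBelow-↭ face-covers σ-inverse)
    ; σ-meets-face = All.map (λ (_ , u∈ , σu∈) → lose σu∈ (∈-map⁺ σ u∈)) α-meets-face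
    ; α-meets-face = All.map enter-face σ-meets-face }
    where
    open QuasiOneFaceMap M
    mapped-face : ∀ L → Cycle (λ x → α (σ x)) L → Cycle (λ x → σ (α x)) (map σ L)
    mapped-face (c ∷ L) cy = Chain-map σ L cy (λ _ → refl)
    enter-face : ∀ {C} → Any (_∈ F) C → ∃ λ u → u ∈ map σ F × α u ∈ C
    enter-face C∩F with find C∩F
    ... | c , c∈C , c∈F with Cycle-preimage F face-cycle c∈F
    ... | p , p∈F , refl = σ p , ∈-map⁺ σ p∈F , c∈C

  covers-insertAfter : ∀ {y P R} → concat ((y ∷ P) ∷ R) ↭ downFrom n → concat ((y ∷ n ∷ P) ∷ R) ↭ downFrom (suc n)
  covers-insertAfter covers = ↭-trans (swap _ n ↭-refl) (prep n covers)

  Cycles-insertAfter : ∀ {f y P R} → concat ((y ∷ P) ∷ R) ↭ downFrom n → All (Cycle f) ((y ∷ P) ∷ R) →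
                       All (Cycle (insertAfter y n f)) ((y ∷ n ∷ P) ∷ R)
  Cycles-insertAfter {f} {y} {P} {R} covers (cy ∷ cys) =
    (insertAfter-at y n f , Chain-transfer P cy (insertAfter-new (>⇒≢ y<)) (λ x∈ → agree (∈-++⁺ˡ x∈)))
    ∷ All.tabulate (λ C∈ → Cycle-cong _ (All.lookup cys C∈) (λ z∈ → agree (∈-++⁺ʳ P (∈-concat⁺′ z∈ C∈))))
    where
    y< : y < n
    y< = ∈-↭downFrom⁻ covers (here refl)
    agree : ∀ {x} → x ∈ P ++ concat R → insertAfter y n f x ≡ f x
    agree x∈ = insertAfter-other (Unique-∷⇒≢ (Unique-↭downFrom covers) x∈) (<⇒≢ (∈-↭downFrom⁻ covers (there x∈)))

  Cycles-extend : ∀ {f Cs} → concat Cs ↭ downFrom n → All (Cycle f) Cs → All (Cycle (extend n f)) ([ n ] ∷ Cs)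
  Cycles-extend {f} {Cs} covers cys =
    [↦]-≡ f n n ∷ All.tabulate (λ C∈ → Cycle-cong _ (All.lookup cys C∈)
                                   (λ z∈ → [↦]-≢ (<⇒≢ (∈-↭downFrom⁻ covers (∈-concat⁺′ z∈ C∈)))))

  addLeaf : ∀ {y P R Ws Q D} → QuasiOneFaceMap n ((y ∷ P) ∷ R) Ws (y ∷ Q) D →
            QuasiOneFaceMap (suc n) ((y ∷ n ∷ P) ∷ R) ([ n ] ∷ Ws) (y ∷ n ∷ Q) D
  addLeaf {y} {P} {R} {Ws} {Q} {D} M = record
    { perms = record { σ = σ′ ; σ⁻¹ = insertAfter⁻¹ y n σ σ⁻¹ ; α = α′ ; α⁻¹ = extend n α⁻¹
                     ; σ-inverse = insertAfter-InverseBelow σ-inverse y< ; α-inverse = extend-InverseBelow α-inverse }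
    ; σ-cycles = Cycles-insertAfter {P = P} σ-covers σ-cycles
    ; α-cycles = Cycles-extend α-covers α-cycles
    ; face-cycle = trans (cong α′ (insertAfter-at y n σ)) ([↦]-≡ α n n) ,
                   Chain-transfer Q face-cycle (extend∘insertAfter-new σ-inverse y<) (λ x∈ → face-other (∈-++⁺ˡ x∈))
    ; face-fixed = All.tabulate (λ d∈ → trans (face-other (∈-++⁺ʳ Q d∈)) (All.lookup face-fixed d∈))
    ; σ-covers = covers-insertAfter {P = P} {R} σ-covers
    ; α-covers = prep n α-covers
    ; face-covers = ↭-trans (swap y n ↭-refl) (prep n face-covers)
    ; σ-meets-face = here (here refl) ∷ All.map (Any.map skip-new) (All.tail σ-meets-face)
    ; α-meets-face = (y , here refl , here (insertAfter-at y n σ)) ∷ All.map reroute α-meets-face }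
    where
    open QuasiOneFaceMap M
    σ′ = insertAfter y n σ
    α′ = extend n α
    y< : y < n
    y< = ∈-↭downFrom⁻ σ-covers (here refl)
    n≢y : n ≢ y
    n≢y = >⇒≢ y<
    face-other : ∀ {x} → x ∈ Q ++ D → α′ (σ′ x) ≡ α (σ x)
    face-other x∈ = extend∘insertAfter-other σ-inverse (∈-↭downFrom⁻ face-covers (there x∈))
                                             (Unique-∷⇒≢ (Unique-↭downFrom face-covers) x∈)
    skip-new : ∀ {z} → z ∈ y ∷ Q → z ∈ y ∷ n ∷ Q
    skip-new (here e) = here e
    skip-new (there z∈) = there (there z∈)
    reroute : ∀ {C} → (∃ λ u → u ∈ y ∷ Q × σ u ∈ C) → ∃ λ u → u ∈ y ∷ n ∷ Q × σ′ u ∈ C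
    reroute (u , here refl , σu∈) = n , there (here refl) , subst (_∈ _) (sym (insertAfter-new n≢y)) σu∈
    reroute (u , there u∈ , σu∈) =
      u , there (there u∈) ,
      subst (_∈ _) (sym (insertAfter-other (Unique-∷⇒≢ (Unique-↭downFrom face-covers) (∈-++⁺ˡ u∈))
                                           (<⇒≢ (∈-↭downFrom⁻ face-covers (there (∈-++⁺ˡ u∈)))))) σu∈

  addDigon : ∀ {y P R z P′ R′ F D} (M : QuasiOneFaceMap n ((y ∷ P) ∷ R) ((z ∷ P′) ∷ R′) F D) →
             QuasiOneFaceMap.σ M y ≡ z →
             QuasiOneFaceMap (suc n) ((y ∷ n ∷ P) ∷ R) ((z ∷ n ∷ P′) ∷ R′) F (n ∷ D)
  addDigon {y} {P} {R} {z} {P′} {R′} {F} {D} M σy≡z = record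
    { perms = record { σ = σ′ ; σ⁻¹ = insertAfter⁻¹ y n σ σ⁻¹ ; α = α′ ; α⁻¹ = insertAfter⁻¹ z n α α⁻¹
                     ; σ-inverse = insertAfter-InverseBelow σ-inverse y< ; α-inverse = insertAfter-InverseBelow α-inverse z< }
    ; σ-cycles = Cycles-insertAfter {P = P} σ-covers σ-cycles
    ; α-cycles = Cycles-insertAfter {P = P′} α-covers α-cycles
    ; face-cycle = Cycle-cong F face-cycle (λ x∈ → face-old (∈-↭downFrom⁻ face-covers (∈-++⁺ˡ x∈)))
    ; face-fixed = insertAfter²-new y< σy≡z
                   ∷ All.tabulate (λ d∈ → trans (face-old (∈-↭downFrom⁻ face-covers (∈-++⁺ʳ F d∈))) (All.lookup face-fixed d∈))
    ; σ-covers = covers-insertAfter {P = P} {R} σ-covers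
    ; α-covers = covers-insertAfter {P = P′} {R′} α-covers
    ; face-covers = ↭-trans (shift n F D) (prep n face-covers)
    ; σ-meets-face = skip-new (All.head σ-meets-face) ∷ All.tail σ-meets-face
    ; α-meets-face = reroute-head (All.head α-meets-face)
                     ∷ All.tabulate (λ C∈ → reroute-tail C∈ (All.lookup (All.tail α-meets-face) C∈)) }
    where
    open QuasiOneFaceMap M
    σ′ = insertAfter y n σ
    α′ = insertAfter z n α
    y< : y < n
    y< = ∈-↭downFrom⁻ σ-covers (here refl)
    z< : z < n
    z< = ∈-↭downFrom⁻ α-covers (here refl)
    σ′-other : ∀ {x} → x < n → x ≢ y → σ′ x ≡ σ x
    σ′-other x< x≢y = insertAfter-other x≢y (<⇒≢ x<)
    face-old : ∀ {x} → x < n → α′ (σ′ x) ≡ α (σ x)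
    face-old = insertAfter²-old σ-inverse y< z< σy≡z
    skip-new : Any (_∈ F) (y ∷ P) → Any (_∈ F) (y ∷ n ∷ P)
    skip-new (here y∈) = here y∈
    skip-new (there P∩F) = there (there P∩F)
    reroute-head : (∃ λ u → u ∈ F × σ u ∈ z ∷ P′) → ∃ λ u → u ∈ F × σ′ u ∈ z ∷ n ∷ P′
    reroute-head (u , u∈ , σu∈) with ≡⊎≢ u y
    ... | inj₁ refl = y , u∈ , there (here (insertAfter-at y n σ))
    ... | inj₂ u≢y with σu∈
    ... | here σu≡z = u , u∈ , here (trans (σ′-other u< u≢y) σu≡z)
      where u< = ∈-↭downFrom⁻ face-covers (∈-++⁺ˡ u∈)
    ... | there σu∈P′ = u , u∈ , there (there (subst (_∈ P′) (sym (σ′-other u< u≢y)) σu∈P′))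
      where u< = ∈-↭downFrom⁻ face-covers (∈-++⁺ˡ u∈)
    reroute-tail : ∀ {C} → C ∈ R′ → (∃ λ u → u ∈ F × σ u ∈ C) → ∃ λ u → u ∈ F × σ′ u ∈ C
    reroute-tail C∈ (u , u∈ , σu∈) with ≡⊎≢ u y
    ... | inj₁ refl = ⊥-elim (Unique[x∷xs]⇒x∉xs (Unique-↭downFrom α-covers)
                                (∈-++⁺ʳ P′ (∈-concat⁺′ (subst (_∈ _) σy≡z σu∈) C∈)))
    ... | inj₂ u≢y = u , u∈ , subst (_∈ _) (sym (σ′-other (∈-↭downFrom⁻ face-covers (∈-++⁺ˡ u∈)) u≢y)) σu∈

module Separators {a b c : ℕ} (X₁ X₂ X₃ : List ℕ) (u : Unique (a ∷ X₁ ++ b ∷ X₂ ++ c ∷ X₃)) where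

  private
    gathered : Unique (a ∷ b ∷ c ∷ X₁ ++ X₂ ++ X₃)
    gathered = Unique-resp-↭ (↭-gather₃ a X₁ b X₂ c X₃) u

  distinct : Distinct3 a b c
  distinct with gathered
  ... | (a≢b ∷ a≢c ∷ _) ∷ (b≢c ∷ _) ∷ _ = distinct3 a≢b a≢c b≢c

  fixes : ∀ {x} → x ∈ X₁ ++ X₂ ++ X₃ → rotate3 a b c x ≡ x
  fixes x∈ with gathered
  ... | (_ ∷ _ ∷ a≢) ∷ (_ ∷ b≢) ∷ c≢ ∷ _ =
    Rotate3.at-other distinct (λ e → All.lookup a≢ x∈ (sym e)) (λ e → All.lookup b≢ x∈ (sym e))
                     (λ e → All.lookup c≢ x∈ (sym e))

  fixes₁ : ∀ {x} → x ∈ X₁ → rotate3 a b c x ≡ x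
  fixes₁ x∈ = fixes (∈-++⁺ˡ x∈)

  fixes₂ : ∀ {x} → x ∈ X₂ → rotate3 a b c x ≡ x
  fixes₂ x∈ = fixes (∈-++⁺ʳ X₁ (∈-++⁺ˡ x∈))

  fixes₃ : ∀ {x} → x ∈ X₃ → rotate3 a b c x ≡ x
  fixes₃ x∈ = fixes (∈-++⁺ʳ X₁ (∈-++⁺ʳ X₂ x∈))

Cycles-merge3 : ∀ {f c₁ P₁ c₂ P₂ c₃ P₃ R} → Unique (concat ((c₁ ∷ P₁) ∷ (c₂ ∷ P₂) ∷ (c₃ ∷ P₃) ∷ R)) →
                All (Cycle f) ((c₁ ∷ P₁) ∷ (c₂ ∷ P₂) ∷ (c₃ ∷ P₃) ∷ R) →
                All (Cycle (λ x → f (rotate3 c₁ c₂ c₃ x))) ((c₁ ∷ P₂ ++ c₂ ∷ P₃ ++ c₃ ∷ P₁) ∷ R)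
Cycles-merge3 {f} {c₁} {P₁} {c₂} {P₂} {c₃} {P₃} {R} u (cy₁ ∷ cy₂ ∷ cy₃ ∷ rest) =
  Chain-++⁺ P₂ (Chain-transfer P₂ cy₂ (cong f at-a) (λ x∈ → cong f (fixes₂ x∈)))
    (Chain-++⁺ P₃ (Chain-transfer P₃ cy₃ (cong f at-b) (λ x∈ → cong f (fixes₃ (∈-++⁺ˡ x∈))))
                  (Chain-transfer P₁ cy₁ (cong f at-c) (λ x∈ → cong f (fixes₁ x∈))))
  ∷ All.tabulate (λ K∈ → Cycle-cong _ (All.lookup rest K∈) (λ x∈ → cong f (fixes₃ (∈-++⁺ʳ P₃ (∈-concat⁺′ x∈ K∈)))))
  where
  open Separators P₁ P₂ (P₃ ++ concat R) u
  open Rotate3 distinct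

Cycle-merge3 : ∀ {f c₁ A c₂ B c₃ C D} → Unique (c₁ ∷ A ++ c₂ ∷ B ++ c₃ ∷ C ++ D) →
               Cycle f (c₁ ∷ A ++ c₂ ∷ B ++ c₃ ∷ C) → Cycle (λ x → f (rotate3 c₁ c₂ c₃ x)) (c₁ ∷ B ++ c₃ ∷ A ++ c₂ ∷ C)
Cycle-merge3 {f} {c₁} {A} {c₂} {B} {c₃} {C} {D} u cy =
  Chain-++⁺ B (Chain-transfer B chain₂ (cong f at-a) (λ x∈ → cong f (fixes₂ x∈)))
    (Chain-++⁺ A (Chain-transfer A chain₁ (cong f at-c) (λ x∈ → cong f (fixes₁ x∈)))
                 (Chain-transfer C chain₃ (cong f at-b) (λ x∈ → cong f (fixes₃ (∈-++⁺ˡ x∈)))))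
  where
  open Separators A B (C ++ D) u
  open Rotate3 distinct
  chain₁ = proj₁ (Chain-++⁻ A cy)
  chain₂ = proj₁ (Chain-++⁻ B (proj₂ (Chain-++⁻ A cy)))
  chain₃ = proj₂ (Chain-++⁻ B (proj₂ (Chain-++⁻ A cy)))

module _ {n : ℕ} where

  -- Had c₂ and c₃ occurred in the other order along F, the face would split into three cycles.
  merge3 : ∀ {c₁ P₁ c₂ P₂ c₃ P₃ R Ws A B C D} →
           QuasiOneFaceMap n ((c₁ ∷ P₁) ∷ (c₂ ∷ P₂) ∷ (c₃ ∷ P₃) ∷ R) Ws (c₁ ∷ A ++ c₂ ∷ B ++ c₃ ∷ C) D →
           QuasiOneFaceMap n ((c₁ ∷ P₂ ++ c₂ ∷ P₃ ++ c₃ ∷ P₁) ∷ R) Ws (c₁ ∷ B ++ c₃ ∷ A ++ c₂ ∷ C) D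
  merge3 {c₁} {P₁} {c₂} {P₂} {c₃} {P₃} {R} {Ws} {A} {B} {C} {D} M = record
    { perms = record { σ = σ′ ; σ⁻¹ = λ x → τ⁻¹ (σ⁻¹ x) ; α = α ; α⁻¹ = α⁻¹
                     ; σ-inverse = InverseBelow-∘ σ-inverse τ-inverse ; α-inverse = α-inverse }
    ; σ-cycles = Cycles-merge3 (Unique-↭downFrom σ-covers) σ-cycles
    ; α-cycles = α-cycles
    ; face-cycle = Cycle-merge3 face-unique face-cycle
    ; face-fixed = All.tabulate (λ d∈ → trans (cong (λ x → α (σ x)) (Fa.fixes₃ (∈-++⁺ʳ C d∈))) (All.lookup face-fixed d∈))
    ; σ-covers = ↭-trans (↭-rotate-pieces₃ c₁ P₁ c₂ P₂ c₃ P₃ (concat R)) σ-covers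
    ; α-covers = α-covers
    ; face-covers = ↭-trans (↭-swap-pieces₂ c₁ A c₂ B c₃ C D) face-covers
    ; σ-meets-face = here (here refl) ∷ All.map (Any.map in-new-face) (All.tail (All.tail (All.tail σ-meets-face)))
    ; α-meets-face = All.map preimage α-meets-face }
    where
    open QuasiOneFaceMap M
    τ = rotate3 c₁ c₂ c₃
    τ⁻¹ = rotate3 c₃ c₂ c₁
    σ′ = λ x → σ (τ x)
    face-unique : Unique (c₁ ∷ A ++ c₂ ∷ B ++ c₃ ∷ C ++ D)
    face-unique = subst Unique (cong (c₁ ∷_) (++-assoc₃ A c₂ B c₃ C D)) (Unique-↭downFrom face-covers)
    module Bl = Separators P₁ P₂ (P₃ ++ concat R) (Unique-↭downFrom σ-covers)
    module Fa = Separators A B (C ++ D) face-unique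
    open Rotate3 Bl.distinct
    module Inv = Rotate3 (Distinct3-reverse Bl.distinct)
    c₁< = ∈-↭downFrom⁻ σ-covers (here refl)
    c₂< = ∈-↭downFrom⁻ σ-covers (there (∈-++⁺ʳ P₁ (here refl)))
    c₃< = ∈-↭downFrom⁻ σ-covers (there (∈-++⁺ʳ P₁ (there (∈-++⁺ʳ P₂ (here refl)))))
    τ-inverse : InverseBelow n τ τ⁻¹
    τ-inverse = rotate3-InverseBelow Bl.distinct c₁< c₂< c₃<
    F′ = c₁ ∷ B ++ c₃ ∷ A ++ c₂ ∷ C
    in-new-face : ∀ {x} → x ∈ c₁ ∷ A ++ c₂ ∷ B ++ c₃ ∷ C → x ∈ F′
    in-new-face {x} x∈ =
      subst (x ∈_) (++-identityʳ F′) (∈-resp-↭ (↭-sym (↭-swap-pieces₂ c₁ A c₂ B c₃ C [])) (∈-++⁺ˡ x∈))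
    τ⁻¹-in-new-face : ∀ {u} → u ∈ c₁ ∷ A ++ c₂ ∷ B ++ c₃ ∷ C → τ⁻¹ u ∈ F′
    τ⁻¹-in-new-face {u} u∈ with position u
    ... | is-a refl = subst (_∈ F′) (sym Inv.at-c) (there (∈-++⁺ʳ B (here refl)))
    ... | is-b refl = subst (_∈ F′) (sym Inv.at-b) (here refl)
    ... | is-c refl = subst (_∈ F′) (sym Inv.at-a) (there (∈-++⁺ʳ B (there (∈-++⁺ʳ A (here refl)))))
    ... | other u≢a u≢b u≢c = subst (_∈ F′) (sym (Inv.at-other u≢c u≢b u≢a)) (in-new-face u∈)
    preimage : ∀ {K} → (∃ λ u → u ∈ c₁ ∷ A ++ c₂ ∷ B ++ c₃ ∷ C × σ u ∈ K) → ∃ λ v → v ∈ F′ × σ′ v ∈ K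
    preimage (u , u∈ , σu∈) =
      τ⁻¹ u , τ⁻¹-in-new-face u∈ ,
      subst (_∈ _) (cong σ (sym (f∘g τ-inverse (∈-↭downFrom⁻ face-covers (∈-++⁺ˡ u∈))))) σu∈

record Realizable (ls ms : List ℕ) (m n : ℕ) : Set where
  constructor realized
  field
    {Bs Ws} : List (List ℕ)
    {F D} : List ℕ
    hypermap : QuasiOneFaceMap n Bs Ws F D
    black-degrees : map length Bs ↭ ls
    white-degrees : map length Ws ↭ ms
    face-degree : length F ≡ m

Realizable-↭ : ∀ {ls ls′ ms ms′ m n} → ls ↭ ls′ → ms ↭ ms′ → Realizable ls ms m n → Realizable ls′ ms′ m n
Realizable-↭ p q (realized M b w f) = realized M (↭-trans b p) (↭-trans w q) f

Realizable-swap : ∀ {ls ms m n} → Realizable ls ms m n → Realizable ms ls m n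
Realizable-swap (realized {F = F} M b w f) = realized (swapColours M) w b (trans (length-map _ F) f)

module _ {n : ℕ} where

  pointBlack : ∀ {K R Ws F D} → QuasiOneFaceMap n (K ∷ R) Ws F D →
               ∃₂ λ c P → c ∈ F × length (c ∷ P) ≡ length K × QuasiOneFaceMap n ((c ∷ P) ∷ R) Ws F D
  pointBlack M with find (All.head (QuasiOneFaceMap.σ-meets-face M))
  ... | c , c∈K , c∈F with ∈-∃++ c∈K
  ... | xs , ys , refl = c , ys ++ xs , c∈F , sym (↭-length (↭-rotate xs c ys)) , rotateBlack xs c ys M

  pointFace : ∀ {c Bs Ws F D} → c ∈ F → QuasiOneFaceMap n Bs Ws F D →
              ∃ λ T → F ↭ c ∷ T × QuasiOneFaceMap n Bs Ws (c ∷ T) D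
  pointFace c∈ M with ∈-∃++ c∈
  ... | xs , ys , refl = ys ++ xs , ↭-rotate xs _ ys , rotateFace xs _ ys M

addDigons : ∀ k {n y P R z W R′ F D} (M : QuasiOneFaceMap n ((y ∷ P) ∷ R) ((z ∷ W) ∷ R′) F D) →
            QuasiOneFaceMap.σ M y ≡ z →
            ∃₂ λ P′ W′ → ∃ λ D′ → QuasiOneFaceMap (k + n) ((y ∷ P′) ∷ R) (W′ ∷ R′) F D′ ×
                                  length P′ ≡ k + length P × length W′ ≡ k + suc (length W)
addDigons zero M _ = _ , _ , _ , M , refl , refl
addDigons (suc k) {n} {y} {P} {R} {z} {W} {R′} {F} M σy≡z
  with addDigons k (rotateWhite [ z ] n W (addDigon M σy≡z)) (insertAfter-at y n (QuasiOneFaceMap.σ M))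
... | P′ , W′ , D′ , M′ , |P′| , |W′| =
  P′ , W′ , D′ , subst (λ N → QuasiOneFaceMap N ((y ∷ P′) ∷ R) (W′ ∷ R′) F D′) (+-suc k n) M′ ,
  trans |P′| (+-suc k (length P)) ,
  trans |W′| (trans (cong (λ w → k + suc w) (length-++ W)) (arith k (length W)))
  where
  arith : ∀ k w → k + suc (w + 1) ≡ suc k + suc w
  arith = solve-∀

Realizable-star : ∀ k → Realizable [ suc k ] [ suc k ] 1 (suc k)
Realizable-star k with addDigons k singleEdge refl
... | P′ , W′ , D′ , M , |P′| , |W′| =
  realized (subst (λ N → QuasiOneFaceMap N ((0 ∷ P′) ∷ []) (W′ ∷ []) [ 0 ] D′) (+-comm k 1) M)
           (↭-reflexive (cong (λ x → [ suc x ]) (trans |P′| (+-identityʳ k))))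
           (↭-reflexive (cong [_] (trans |W′| (+-comm k 1))))
           refl

Realizable-attachWhite : ∀ k {ℓ ls ms m n} → Realizable (ℓ ∷ ls) ms m n →
                         Realizable ((suc k + ℓ) ∷ ls) (suc k ∷ ms) (suc m) (suc k + n)
Realizable-attachWhite k {n = n} (realized {Ws = Ws} {D = D} M b w f) with ↭-map-inv length b
... | C ∷ R , refl , Bs↭ with pointBlack (reorderBlack Bs↭ M)
... | y , P , y∈F , |yP| , M₂ with pointFace y∈F M₂
... | Q , F↭ , M₃ with addDigons k (addLeaf M₃) (insertAfter-at y n (QuasiOneFaceMap.σ M₃))
... | P′ , W′ , D′ , M₄ , |P′| , |W′| =
  realized (subst (λ N → QuasiOneFaceMap N ((y ∷ P′) ∷ R) (W′ ∷ Ws) (y ∷ n ∷ Q) D′) (+-suc k n) M₄)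
           (↭-reflexive (cong (λ x → suc x ∷ map length R) (trans |P′| (cong (k +_) |yP|))))
           (↭-trans (↭-reflexive (cong (_∷ map length Ws) (trans |W′| (+-comm k 1)))) (prep (suc k) w))
           (cong suc (trans (sym (↭-length F↭)) f))

merge3-Realizable : ∀ {n c₁ P₁ c₂ P₂ c₃ P₃ R Ws A B C D ms m} →
                    QuasiOneFaceMap n ((c₁ ∷ P₁) ∷ (c₂ ∷ P₂) ∷ (c₃ ∷ P₃) ∷ R) Ws (c₁ ∷ A ++ c₂ ∷ B ++ c₃ ∷ C) D →
                    map length Ws ↭ ms → length (c₁ ∷ A ++ c₂ ∷ B ++ c₃ ∷ C) ≡ m →
                    Realizable ((length (c₁ ∷ P₁) + length (c₂ ∷ P₂) + length (c₃ ∷ P₃)) ∷ map length R) ms m n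
merge3-Realizable {c₁ = c₁} {P₁} {c₂} {P₂} {c₃} {P₃} {R} {A = A} {B} {C} M w f =
  realized (merge3 M)
           (↭-reflexive (cong (_∷ map length R)
             (trans (length-pieces₃ c₁ P₂ c₂ P₃ c₃ P₁) (rotate-sum (length P₁) (length P₂) (length P₃)))))
           w
           (trans (length-pieces₃ c₁ B c₃ A c₂ C)
                  (trans (swap-sum (length A) (length B) (length C)) (trans (sym (length-pieces₃ c₁ A c₂ B c₃ C)) f)))
  where
  rotate-sum : ∀ x y z → suc y + suc z + suc x ≡ suc x + suc y + suc z
  rotate-sum = solve-∀
  swap-sum : ∀ x y z → suc y + suc x + suc z ≡ suc x + suc y + suc z
  swap-sum = solve-∀

merge3-Realizable-anyOrder : ∀ {n c₁ P₁ c₂ P₂ c₃ P₃ R Ws T D ms m} →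
                             QuasiOneFaceMap n ((c₁ ∷ P₁) ∷ (c₂ ∷ P₂) ∷ (c₃ ∷ P₃) ∷ R) Ws (c₁ ∷ T) D →
                             c₂ ∈ T → c₃ ∈ T → c₂ ≢ c₃ → map length Ws ↭ ms → length (c₁ ∷ T) ≡ m →
                             Realizable ((length (c₁ ∷ P₁) + length (c₂ ∷ P₂) + length (c₃ ∷ P₃)) ∷ map length R) ms m n
merge3-Realizable-anyOrder {P₁ = P₁} {P₂ = P₂} {P₃ = P₃} {R} M c₂∈ c₃∈ c₂≢c₃ w f with ∈-∃++-ordered c₂∈ c₃∈ c₂≢c₃
... | inj₁ (A , B , C , refl) = merge3-Realizable M w f
... | inj₂ (A , B , C , refl) =
  Realizable-↭ (↭-reflexive (cong (_∷ map length R) (swap-last (length P₁) (length P₃) (length P₂)))) ↭-refl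
               (merge3-Realizable (reorderBlack (prep _ (swap _ _ ↭-refl)) M) w f)
  where
  swap-last : ∀ x y z → suc x + suc y + suc z ≡ suc x + suc z + suc y
  swap-last = solve-∀

module _ {n : ℕ} where

  cycleBlack₃ : ∀ {K₁ K₂ K₃ R Ws F D} → QuasiOneFaceMap n (K₁ ∷ K₂ ∷ K₃ ∷ R) Ws F D →
                QuasiOneFaceMap n (K₂ ∷ K₃ ∷ K₁ ∷ R) Ws F D
  cycleBlack₃ = reorderBlack (↭-trans (swap _ _ ↭-refl) (prep _ (swap _ _ ↭-refl)))

Realizable-mergeBlack3 : ∀ {p q r ls ms m n} → Realizable (p ∷ q ∷ r ∷ ls) ms m n → Realizable ((p + q + r) ∷ ls) ms m n
Realizable-mergeBlack3 (realized {F = F} M b w f) with ↭-map-inv length b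
... | K₁ ∷ K₂ ∷ K₃ ∷ R , refl , Bs↭ with pointBlack (reorderBlack Bs↭ M)
... | c₁ , P₁ , c₁∈ , |K₁| , M₁ with pointBlack (cycleBlack₃ M₁)
... | c₂ , P₂ , c₂∈ , |K₂| , M₂ with pointBlack (cycleBlack₃ M₂)
... | c₃ , P₃ , c₃∈ , |K₃| , M₃ with pointFace c₁∈ (cycleBlack₃ M₃)
... | T , F↭ , M₄ =
  Realizable-↭ (↭-reflexive (cong (_∷ map length R) (cong₂ _+_ (cong₂ _+_ |K₁| |K₂|) |K₃|))) ↭-refl
    (merge3-Realizable-anyOrder M₄ (in-tail c₂∈ (λ e → a≢b (sym e))) (in-tail c₃∈ (λ e → a≢c (sym e))) b≢c w
                                (trans (sym (↭-length F↭)) f))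
  where
  open Distinct3 (Separators.distinct P₁ P₂ (P₃ ++ concat R) (Unique-↭downFrom (QuasiOneFaceMap.σ-covers M₄)))
  in-tail : ∀ {c} → c ∈ F → c ≢ c₁ → c ∈ T
  in-tail c∈ c≢c₁ with ∈-resp-↭ F↭ c∈
  ... | here c≡c₁ = ⊥-elim (c≢c₁ c≡c₁)
  ... | there c∈T = c∈T

Realizable-cast : ∀ {ls ms m m′ n n′} → m ≡ m′ → n ≡ n′ → Realizable ls ms m n → Realizable ls ms m′ n′
Realizable-cast refl refl R = R

Realizable-attachBlack : ∀ k {ℓ ls ms m n} → Realizable ls (ℓ ∷ ms) m n →
                         Realizable (suc k ∷ ls) ((suc k + ℓ) ∷ ms) (suc m) (suc k + n)
Realizable-attachBlack k R = Realizable-swap (Realizable-attachWhite k (Realizable-swap R))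

sum-≥ : ∀ {s} L → All (s ≤_) L → length L * s ≤ sum L
sum-≥ [] [] = z≤n
sum-≥ (x ∷ L) (s≤x ∷ s≤L) = +-mono-≤ s≤x (sum-≥ L s≤L)

sum-≤ : ∀ {s} L → All (_≤ s) L → sum L ≤ length L * s
sum-≤ [] [] = z≤n
sum-≤ (x ∷ L) (x≤s ∷ L≤s) = +-mono-≤ x≤s (sum-≤ L L≤s)

sum-≡ : ∀ {s} L → All (_≡ s) L → sum L ≡ length L * s
sum-≡ [] [] = refl
sum-≡ (x ∷ L) (refl ∷ L≡s) = cong (x +_) (sum-≡ L L≡s)

1+x*s≢y*s : ∀ {s} x y → 2 ≤ s → 1 + x * s ≢ y * s
1+x*s≢y*s {s} x y 2≤s e with y ≤? x
... | yes y≤x = <-irrefl refl (subst (_≤ x * s) (sym e) (*-monoˡ-≤ s y≤x))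
... | no y≰x = <-irrefl refl (≤-trans (+-monoˡ-≤ (x * s) 2≤s) (subst (s + x * s ≤_) (sym e) (*-monoˡ-≤ s (≰⇒> y≰x))))

-- (K - 2)(s - 2) ≥ 0 turns 1 + Ks ≤ 2n into K + s ≤ n + 1.
product-bound : ∀ {n K s} → 2 ≤ s → 3 ≤ K → 1 + K * s ≤ 2 * n → K + s ≤ suc n
product-bound {n} {K} {suc (suc zero)} _ _ 1+2K≤2n with n ≤? K
... | yes n≤K = ⊥-elim (<-irrefl refl (≤-trans (s≤s (subst (_≤ K * 2) (*-comm n 2) (*-monoˡ-≤ 2 n≤K))) 1+2K≤2n))
... | no n≰K = subst (_≤ suc n) (+-comm 2 K) (s≤s (≰⇒> n≰K))
product-bound {s = suc zero} (s≤s ()) _ _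
product-bound {n} {suc (suc (suc u))} {suc (suc (suc t))} _ (s≤s (s≤s (s≤s _))) h = *-cancelˡ-≤ 2 (begin
  2 * (3 + u + (3 + t))                     ≤⟨ m≤m+n _ (u + t + u * t) ⟩
  2 * (3 + u + (3 + t)) + (u + t + u * t)   ≡⟨ expand u t ⟩
  1 + (3 + u) * (3 + t) + 2                 ≤⟨ +-monoˡ-≤ 2 h ⟩
  2 * n + 2                                 ≡⟨ double n ⟩
  2 * suc n                                 ∎)
  where
  open ≤-Reasoning
  expand : ∀ u t → 2 * (3 + u + (3 + t)) + (u + t + u * t) ≡ 1 + (3 + u) * (3 + t) + 2
  expand = solve-∀
  double : ∀ n → 2 * n + 2 ≡ 2 * suc n
  double = solve-∀

Positive : List ℕ → Set
Positive = All (1 ≤_)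

record Degrees (ls ms : List ℕ) (n : ℕ) : Set where
  constructor degrees
  field
    black-positive : Positive ls
    white-positive : Positive ms
    black-sum : sum ls ≡ n
    white-sum : sum ms ≡ n

Degrees-swap : ∀ {ls ms n} → Degrees ls ms n → Degrees ms ls n
Degrees-swap (degrees pl pm sl sm) = degrees pm pl sm sl

PlanarAt : ℕ → Set
PlanarAt n = ∀ {ls ms m} → Degrees ls ms n → 1 ≤ length ls → 1 ≤ length ms →
             length ls + length ms ≡ suc m → m ≤ n → 1 ∈ ls ⊎ 1 ∈ ms → Realizable ls ms m n

PlanarBelow : ℕ → Set
PlanarBelow n = ∀ {k} → k < n → PlanarAt k

Realizable-starBlack : ∀ ms → Positive ms → 1 ≤ length ms → Realizable [ sum ms ] ms (length ms) (sum ms)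
Realizable-starBlack (zero ∷ _) (() ∷ _) _
Realizable-starBlack (suc k ∷ []) _ _ =
  subst (λ w → Realizable [ w ] [ suc k ] 1 w) (sym (+-identityʳ (suc k))) (Realizable-star k)
Realizable-starBlack (suc k ∷ k′ ∷ ms) (_ ∷ pos) _ = Realizable-attachWhite k (Realizable-starBlack (k′ ∷ ms) pos (s≤s z≤n))

planar-oneBlack : ∀ {x ms m n} → Degrees [ x ] ms n → 1 ≤ length ms → suc (length ms) ≡ suc m → Realizable [ x ] ms m n
planar-oneBlack {x} {ms} (degrees _ pm sl sm) 1≤|ms| e =
  Realizable-↭ (↭-reflexive (cong [_] (trans sm (trans (sym sl) (+-identityʳ x))))) ↭-refl
    (Realizable-cast (suc-injective e) sm (Realizable-starBlack ms pm 1≤|ms|))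

planar-peelLeaf : ∀ {lr ms m n} → PlanarBelow n → Degrees (1 ∷ lr) ms n → 1 ≤ length lr →
                  suc (length lr) + length ms ≡ suc m → m ≤ n → 1 ∈ lr ++ ms → Realizable (1 ∷ lr) ms m n
planar-peelLeaf {lr} {ms} {m} {n} IH (degrees (_ ∷ plr) pm sl sm) 1≤|lr| len m≤n one with any? (2 ≤?_) ms
... | no no-big = ⊥-elim (<-irrefl refl (begin-strict
  length ms             <⟨ +-monoˡ-≤ (length ms) 1≤|lr| ⟩
  length lr + length ms ≡⟨ suc-injective len ⟩
  m                     ≤⟨ m≤n ⟩
  n                     ≡⟨ sym sm ⟩
  sum ms                ≤⟨ sum-≤ ms (All.map (λ ¬2≤x → ≤-pred (≰⇒> ¬2≤x)) (¬Any⇒All¬ ms no-big)) ⟩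
  length ms * 1         ≡⟨ *-identityʳ (length ms) ⟩
  length ms             ∎))
  where open ≤-Reasoning
... | yes big with find big
... | zero , _ , ()
... | suc zero , _ , s≤s ()
... | suc (suc w) , w∈ , _ with ∈⇒↭∷ w∈
... | mr , ms↭ =
  Realizable-↭ ↭-refl (↭-sym ms↭) (Realizable-cast (sym m≡) sl (Realizable-attachBlack 0 smaller))
  where
  |ms| : length ms ≡ suc (length mr)
  |ms| = ↭-length ms↭
  m≡ : m ≡ suc (length lr + length mr)
  m≡ = trans (sym (suc-injective len)) (trans (cong (length lr +_) |ms|) (+-suc (length lr) (length mr)))
  smaller : Realizable lr (suc w ∷ mr) (length lr + length mr) (sum lr)
  smaller = IH (subst (suc (sum lr) ≤_) sl ≤-refl)
    (degrees plr (s≤s z≤n ∷ All.tail (All-resp-↭ ms↭ pm)) refl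
             (suc-injective (trans (sym (sum-↭ ms↭)) (trans sm (sym sl)))))
    1≤|lr| (s≤s z≤n) (+-suc (length lr) (length mr))
    (≤-pred (subst₂ _≤_ m≡ (sym sl) m≤n))
    (one′ (∈-++⁻ lr one))
    where
    one′ : 1 ∈ lr ⊎ 1 ∈ ms → 1 ∈ lr ⊎ 1 ∈ suc w ∷ mr
    one′ (inj₁ 1∈lr) = inj₁ 1∈lr
    one′ (inj₂ 1∈ms) with ∈-resp-↭ ms↭ 1∈ms
    ... | there 1∈mr = inj₂ (there 1∈mr)

planar-peelBlackMinimum : ∀ {lr lr′ ms mr s w m n} → PlanarBelow n → Degrees (1 ∷ lr) ms n →
                   lr ↭ s ∷ lr′ → ms ↭ w ∷ mr → 1 ≤ s → s < w →
                   suc (length lr) + length ms ≡ suc m → m + s ≤ suc n → Realizable (1 ∷ lr) ms m n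
planar-peelBlackMinimum {lr} {lr′} {ms} {mr} {suc s′} {w} {m} {n} IH (degrees (_ ∷ plr) pm sl sm) lr↭ ms↭ _ s<w len bound =
  Realizable-↭ (↭-trans (swap _ 1 ↭-refl) (prep 1 (↭-sym lr↭))) (↭-trans (↭-reflexive (cong (_∷ mr) s+t≡w)) (↭-sym ms↭))
    (Realizable-cast (sym m≡) n≡ (Realizable-attachBlack s′ smaller))
  where
  open ≡-Reasoning
  s = suc s′
  t = w ∸ s
  s+t≡w : s + t ≡ w
  s+t≡w = m+[n∸m]≡n (<⇒≤ s<w)
  n≡′ : n ≡ s + suc (sum lr′)
  n≡′ = trans (sym sl) (trans (cong suc (sum-↭ lr↭)) (sym (+-suc s (sum lr′))))
  n≡ : s + suc (sum lr′) ≡ n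
  n≡ = sym n≡′
  m≡ : m ≡ suc (length lr′ + suc (length mr))
  m≡ = trans (sym (suc-injective len)) (cong₂ _+_ (↭-length lr↭) (↭-length ms↭))
  white-sum : t + sum mr ≡ suc (sum lr′)
  white-sum = +-cancelˡ-≡ s _ _ (begin
    s + (t + sum mr)  ≡⟨ sym (+-assoc s t (sum mr)) ⟩
    s + t + sum mr    ≡⟨ cong (_+ sum mr) s+t≡w ⟩
    w + sum mr        ≡⟨ sym (sum-↭ ms↭) ⟩
    sum ms            ≡⟨ trans sm n≡′ ⟩
    s + suc (sum lr′) ∎)
  smaller : Realizable (1 ∷ lr′) (t ∷ mr) (length lr′ + suc (length mr)) (suc (sum lr′))
  smaller = IH (subst (suc (sum lr′) <_) n≡ (s≤s (m≤n+m (suc (sum lr′)) s′)))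
    (degrees (s≤s z≤n ∷ All.tail (All-resp-↭ lr↭ plr)) (m<n⇒0<n∸m s<w ∷ All.tail (All-resp-↭ ms↭ pm)) refl white-sum)
    (s≤s z≤n) (s≤s z≤n) refl
    (+-cancelʳ-≤ s _ _ (≤-pred (subst₂ _≤_ (cong (_+ s) m≡) (cong suc (trans n≡′ (+-comm s _))) bound)))
    (inj₁ (here refl))

planar-peelWhiteMinimum : ∀ {lr lr″ ms mr′ s v m n} → PlanarBelow n → Degrees (1 ∷ lr) ms n →
                   ms ↭ s ∷ mr′ → lr ↭ v ∷ lr″ → 1 ≤ s → s < v → 2 ≤ length ms →
                   suc (length lr) + length ms ≡ suc m → m + s ≤ suc n → Realizable (1 ∷ lr) ms m n
planar-peelWhiteMinimum {lr} {lr″} {ms} {mr′} {suc s′} {v} {m} {n} IH (degrees (_ ∷ plr) pm sl sm) ms↭ lr↭ _ s<v 2≤|ms| len bound =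
  Realizable-↭ (↭-trans (↭-reflexive (cong (λ x → x ∷ 1 ∷ lr″) s+t≡v)) (↭-trans (swap v 1 ↭-refl) (prep 1 (↭-sym lr↭))))
               (↭-sym ms↭)
    (Realizable-cast (sym m≡) (sym n≡′) (Realizable-attachWhite s′ smaller))
  where
  open ≡-Reasoning
  s = suc s′
  t = v ∸ s
  k = t + suc (sum lr″)
  s+t≡v : s + t ≡ v
  s+t≡v = m+[n∸m]≡n (<⇒≤ s<v)
  regroup : ∀ s t S → suc (s + t + S) ≡ s + (t + suc S)
  regroup = solve-∀
  n≡′ : n ≡ s + k
  n≡′ = begin
    n                       ≡⟨ sym sl ⟩
    suc (sum lr)            ≡⟨ cong suc (sum-↭ lr↭) ⟩
    suc (v + sum lr″)       ≡⟨ cong (λ x → suc (x + sum lr″)) (sym s+t≡v) ⟩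
    suc (s + t + sum lr″)   ≡⟨ regroup s t (sum lr″) ⟩
    s + k                   ∎
  m≡ : m ≡ suc (suc (length lr″) + length mr′)
  m≡ = trans (sym (suc-injective len))
             (trans (cong₂ _+_ (↭-length lr↭) (↭-length ms↭)) (+-suc (suc (length lr″)) (length mr′)))
  white-sum : sum mr′ ≡ k
  white-sum = +-cancelˡ-≡ s _ _ (trans (sym (sum-↭ ms↭)) (trans sm n≡′))
  smaller : Realizable (t ∷ 1 ∷ lr″) mr′ (suc (length lr″) + length mr′) k
  smaller = IH (subst (k <_) (sym n≡′) (s≤s (m≤n+m k s′)))
    (degrees (m<n⇒0<n∸m s<v ∷ s≤s z≤n ∷ All.tail (All-resp-↭ lr↭ plr)) (All.tail (All-resp-↭ ms↭ pm)) refl white-sum)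
    (s≤s z≤n) (≤-pred (subst (2 ≤_) (↭-length ms↭) 2≤|ms|)) refl
    (+-cancelʳ-≤ s _ _ (≤-pred (subst₂ _≤_ (cong (_+ s) m≡) (cong suc (trans n≡′ (+-comm s k))) bound)))
    (inj₁ (there (here refl)))

minimum : ∀ L → 1 ≤ length L → ∃ λ s → s ∈ L × All (s ≤_) L
minimum (x ∷ L) _ = min x L , selected , min≤⊤ x L ∷ min≤xs x L
  where
  selected : min x L ∈ x ∷ L
  selected with argmin-sel (λ y → y) x L
  ... | inj₁ min≡x = here min≡x
  ... | inj₂ min∈L = there min∈L

equal-if-none-above : ∀ {s L} → All (s ≤_) L → ¬ Any (s <_) L → All (_≡ s) L
equal-if-none-above {L = L} s≤L none =
  All.tabulate (λ x∈ → ≤-antisym (≮⇒≥ (λ s<x → none (lose x∈ s<x))) (All.lookup s≤L x∈))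

data MinimumPosition (s : ℕ) (lr ms : List ℕ) : Set where
  black-minimum : s ∈ lr → ∃ (λ w → w ∈ ms × s < w) → MinimumPosition s lr ms
  white-minimum : s ∈ ms → ∃ (λ v → v ∈ lr × s < v) → MinimumPosition s lr ms
  all-equal : All (_≡ s) lr → All (_≡ s) ms → MinimumPosition s lr ms

minimumPosition : ∀ {s} lr ms → s ∈ lr ++ ms → All (s ≤_) (lr ++ ms) → 1 ≤ length lr → 1 ≤ length ms → MinimumPosition s lr ms
minimumPosition {s} lr ms s∈ s≤ 1≤|lr| 1≤|ms| with any? (s <?_) ms | any? (s <?_) lr | s ∈? lr
... | yes above-ms | _ | yes s∈lr = black-minimum s∈lr (find above-ms)
... | _ | yes above-lr | no s∉lr = white-minimum (in-ms (∈-++⁻ lr s∈)) (find above-lr)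
  where
  in-ms : s ∈ lr ⊎ s ∈ ms → s ∈ ms
  in-ms (inj₁ s∈lr) = ⊥-elim (s∉lr s∈lr)
  in-ms (inj₂ s∈ms) = s∈ms
... | no none-ms | yes above-lr | yes _ =
  white-minimum (head-∈ ms 1≤|ms| (equal-if-none-above (++⁻ʳ lr s≤) none-ms)) (find above-lr)
... | no none-ms | no none-lr | _ =
  all-equal (equal-if-none-above (++⁻ˡ lr s≤) none-lr) (equal-if-none-above (++⁻ʳ lr s≤) none-ms)
... | yes _ | no none-lr | no s∉lr = ⊥-elim (s∉lr (head-∈ lr 1≤|lr| (equal-if-none-above (++⁻ˡ lr s≤) none-lr)))

planar-peelMinimum : ∀ {lr ms m n} → PlanarBelow n → Degrees (1 ∷ lr) ms n → 1 ≤ length lr → 2 ≤ length ms →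
                     suc (length lr) + length ms ≡ suc m → m ≤ n → All (2 ≤_) (lr ++ ms) → Realizable (1 ∷ lr) ms m n
planar-peelMinimum {lr} {ms} {m} {n} IH d@(degrees _ _ sl sm) 1≤|lr| 2≤|ms| len m≤n two≤
  with minimum (lr ++ ms) (subst (1 ≤_) (sym (length-++ lr)) (≤-trans 1≤|lr| (m≤m+n _ _)))
... | s , s∈ , s≤ = peel (minimumPosition lr ms s∈ s≤ 1≤|lr| (≤-trans (s≤s z≤n) 2≤|ms|))
  where
  2≤s : 2 ≤ s
  2≤s = All.lookup two≤ s∈
  |lr++ms| : length (lr ++ ms) ≡ m
  |lr++ms| = trans (length-++ lr) (suc-injective len)
  bound : m + s ≤ suc n
  bound = product-bound 2≤s (subst (3 ≤_) (suc-injective len) (+-mono-≤ 1≤|lr| 2≤|ms|)) (begin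
    1 + m * s                     ≡⟨ cong (λ k → 1 + k * s) (sym |lr++ms|) ⟩
    1 + length (lr ++ ms) * s     ≤⟨ s≤s (sum-≥ (lr ++ ms) s≤) ⟩
    1 + sum (lr ++ ms)            ≡⟨ cong suc (sum-++ lr ms) ⟩
    1 + sum lr + sum ms           ≡⟨ cong₂ _+_ sl sm ⟩
    n + n                         ≡⟨ twice n ⟩
    2 * n                         ∎)
    where
    open ≤-Reasoning
    twice : ∀ n → n + n ≡ 2 * n
    twice = solve-∀
  peel : MinimumPosition s lr ms → Realizable (1 ∷ lr) ms m n
  peel (black-minimum s∈lr (w , w∈ , s<w)) =
    planar-peelBlackMinimum IH d (proj₂ (∈⇒↭∷ s∈lr)) (proj₂ (∈⇒↭∷ w∈)) (≤-trans (s≤s z≤n) 2≤s) s<w len bound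
  peel (white-minimum s∈ms (v , v∈ , s<v)) =
    planar-peelWhiteMinimum IH d (proj₂ (∈⇒↭∷ s∈ms)) (proj₂ (∈⇒↭∷ v∈)) (≤-trans (s≤s z≤n) 2≤s) s<v 2≤|ms| len bound
  peel (all-equal lr≡s ms≡s) =
    ⊥-elim (1+x*s≢y*s (length lr) (length ms) 2≤s
             (trans (cong suc (sym (sum-≡ lr lr≡s))) (trans sl (trans (sym sm) (sum-≡ ms ms≡s)))))

Degrees-↭ : ∀ {ls ls′ ms ms′ n} → ls ↭ ls′ → ms ↭ ms′ → Degrees ls ms n → Degrees ls′ ms′ n
Degrees-↭ p q (degrees pl pm sl sm) = degrees (All-resp-↭ p pl) (All-resp-↭ q pm) (trans (sym (sum-↭ p)) sl) (trans (sym (sum-↭ q)) sm)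

planar-withLeaf : ∀ {lr ms m n} → PlanarBelow n → Degrees (1 ∷ lr) ms n → 1 ≤ length lr → 2 ≤ length ms →
                  suc (length lr) + length ms ≡ suc m → m ≤ n → Realizable (1 ∷ lr) ms m n
planar-withLeaf {lr} {ms} IH d 1≤|lr| 2≤|ms| len m≤n with 1 ∈? (lr ++ ms)
... | yes one = planar-peelLeaf IH d 1≤|lr| len m≤n one
... | no no-one = planar-peelMinimum IH d 1≤|lr| 2≤|ms| len m≤n
                    (All.tabulate (λ x∈ → at-least-two (All.lookup positive x∈) (λ { refl → no-one x∈ })))
  where
  positive : Positive (lr ++ ms)
  positive = ++⁺ (All.tail (Degrees.black-positive d)) (Degrees.white-positive d)
  at-least-two : ∀ {x} → 1 ≤ x → x ≢ 1 → 2 ≤ x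
  at-least-two {suc zero} _ x≢1 = ⊥-elim (x≢1 refl)
  at-least-two {suc (suc x)} _ _ = s≤s (s≤s z≤n)

planar-withBlackLeaf : ∀ {ls ms m n} → PlanarBelow n → Degrees ls ms n → 2 ≤ length ls → 2 ≤ length ms →
                       length ls + length ms ≡ suc m → m ≤ n → 1 ∈ ls → Realizable ls ms m n
planar-withBlackLeaf IH d 2≤|ls| 2≤|ms| len m≤n 1∈ls with ∈⇒↭∷ 1∈ls
... | lr , ls↭ =
  Realizable-↭ (↭-sym ls↭) ↭-refl
    (planar-withLeaf IH (Degrees-↭ ls↭ ↭-refl d) (≤-pred (subst (2 ≤_) (↭-length ls↭) 2≤|ls|)) 2≤|ms|
                     (trans (cong (_+ _) (sym (↭-length ls↭))) len) m≤n)

planar-step : ∀ n → PlanarBelow n → PlanarAt n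
planar-step n IH {x ∷ []} d _ 1≤|ms| len _ _ = planar-oneBlack d 1≤|ms| len
planar-step n IH {x ∷ y ∷ ls} {z ∷ []} d _ _ len _ _ =
  Realizable-swap (planar-oneBlack (Degrees-swap d) (s≤s z≤n) (trans (+-comm 1 _) len))
planar-step n IH {ls@(_ ∷ _ ∷ _)} {ms@(_ ∷ _ ∷ _)} d _ _ len m≤n (inj₁ 1∈ls) =
  planar-withBlackLeaf IH d (s≤s (s≤s z≤n)) (s≤s (s≤s z≤n)) len m≤n 1∈ls
planar-step n IH {ls@(_ ∷ _ ∷ _)} {ms@(_ ∷ _ ∷ _)} d _ _ len m≤n (inj₂ 1∈ms) =
  Realizable-swap (planar-withBlackLeaf IH (Degrees-swap d) (s≤s (s≤s z≤n)) (s≤s (s≤s z≤n))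
                                        (trans (+-comm (length ms) (length ls)) len) m≤n 1∈ms)

planar : ∀ n → PlanarAt n
planar = <-rec PlanarAt planar-step

realizable-splitBlack : ∀ {p ls ms m n} → Degrees ls ms n → p ∈ ls → 3 ≤ p →
                        (∀ {ls′} → Degrees ls′ ms n → 1 ≤ length ls′ → length ls′ ≡ 2 + length ls → 1 ∈ ls′ →
                                   Realizable ls′ ms m n) →
                        Realizable ls ms m n
realizable-splitBlack {suc (suc (suc p))} {ls} (degrees pl pm sl sm) p∈ (s≤s (s≤s (s≤s _))) realize with ∈⇒↭∷ p∈
... | lr , ls↭ =
  Realizable-↭ (↭-trans (↭-reflexive (cong (_∷ lr) (+-suc-suc p))) (↭-sym ls↭)) ↭-refl
    (Realizable-mergeBlack3
      (realize (degrees (s≤s z≤n ∷ s≤s z≤n ∷ s≤s z≤n ∷ All.tail (All-resp-↭ ls↭ pl)) pm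
                        (trans (regroup p (sum lr)) (trans (sym (sum-↭ ls↭)) sl)) sm)
               (s≤s z≤n) (cong (2 +_) (sym (↭-length ls↭))) (there (here refl))))
  where
  +-suc-suc : ∀ p → suc p + 1 + 1 ≡ suc (suc (suc p))
  +-suc-suc = solve-∀
  regroup : ∀ p S → suc p + (1 + (1 + S)) ≡ suc (suc (suc p)) + S
  regroup = solve-∀

no-big-degree : ∀ {g ls ms m n} → Degrees ls ms n → length ls + length ms + 2 * suc g ≡ suc m → m ≤ n →
                ¬ Any (3 ≤_) ls → ¬ Any (3 ≤_) ms → ⊥
no-big-degree {g} {ls} {ms} {m} {n} (degrees _ _ sl sm) len m≤n small-ls small-ms = <-irrefl refl (begin-strict
  suc a              <⟨ n<1+n (suc a) ⟩
  2 + a              ≡⟨ +-comm 2 a ⟩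
  a + 2              ≤⟨ +-monoʳ-≤ a (*-monoʳ-≤ 2 (s≤s z≤n)) ⟩
  a + 2 * suc g      ≡⟨ len ⟩
  suc m              ≤⟨ s≤s m≤n ⟩
  suc n              ≤⟨ s≤s n≤a ⟩
  suc a              ∎)
  where
  open ≤-Reasoning
  a = length ls + length ms
  at-most-2 : ∀ L → ¬ Any (3 ≤_) L → sum L ≤ length L * 2
  at-most-2 L small = sum-≤ L (All.map (λ ¬3≤x → ≤-pred (≰⇒> ¬3≤x)) (¬Any⇒All¬ L small))
  n≤a : n ≤ a
  n≤a = *-cancelˡ-≤ 2 (begin
    2 * n                          ≡⟨ twice n ⟩
    n + n                          ≡⟨ cong₂ _+_ (sym sl) (sym sm) ⟩
    sum ls + sum ms                ≤⟨ +-mono-≤ (at-most-2 ls small-ls) (at-most-2 ms small-ms) ⟩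
    length ls * 2 + length ms * 2  ≡⟨ regroup (length ls) (length ms) ⟩
    2 * a                          ∎)
    where
    twice : ∀ n → 2 * n ≡ n + n
    twice = solve-∀
    regroup : ∀ x y → x * 2 + y * 2 ≡ 2 * (x + y)
    regroup = solve-∀

realizable : ∀ g {ls ms m n} → Degrees ls ms n → 1 ≤ length ls → 1 ≤ length ms →
             length ls + length ms + 2 * g ≡ suc m → m ≤ n → (g ≡ 0 → 1 ∈ ls ⊎ 1 ∈ ms) → Realizable ls ms m n
realizable zero d 1≤|ls| 1≤|ms| len m≤n leaf = planar _ d 1≤|ls| 1≤|ms| (trans (sym (+-identityʳ _)) len) m≤n (leaf refl)
realizable (suc g) {ls} {ms} {m} d 1≤|ls| 1≤|ms| len m≤n _ with any? (3 ≤?_) ls | any? (3 ≤?_) ms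
... | yes big-ls | _ =
  let (_ , p∈ , 3≤p) = find big-ls in
  realizable-splitBlack d p∈ 3≤p λ d′ 1≤|ls′| |ls′| 1∈ls′ →
    realizable g d′ 1≤|ls′| 1≤|ms|
      (trans (cong (λ a → a + length ms + 2 * g) |ls′|) (trans (more-black (length ls) (length ms) g) len)) m≤n
      (λ _ → inj₁ 1∈ls′)
  where
  more-black : ∀ a b g → 2 + a + b + 2 * g ≡ a + b + 2 * suc g
  more-black = solve-∀
... | no _ | yes big-ms =
  let (_ , p∈ , 3≤p) = find big-ms in
  Realizable-swap (realizable-splitBlack (Degrees-swap d) p∈ 3≤p λ d′ 1≤|ms′| |ms′| 1∈ms′ →
    Realizable-swap (realizable g (Degrees-swap d′) 1≤|ls| 1≤|ms′|
      (trans (cong (λ b → length ls + b + 2 * g) |ms′|) (trans (more-white (length ls) (length ms) g) len)) m≤n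
      (λ _ → inj₂ 1∈ms′)))
  where
  more-white : ∀ a b g → a + (2 + b) + 2 * g ≡ a + b + 2 * suc g
  more-white = solve-∀
... | no small-ls | no small-ms = ⊥-elim (no-big-degree d len m≤n small-ls small-ms)

module Connectivity {n Bs Ws F D} (M : QuasiOneFaceMap n Bs Ws F D) where
  open QuasiOneFaceMap M

  σP = toPermutation σ-inverse
  αP = toPermutation α-inverse

  data Reaches (x : ℕ) : ℕ → Set where
    start : Reaches x x
    viaσ : ∀ {y} → Reaches x y → Reaches x (σ y)
    viaα : ∀ {y} → Reaches x y → Reaches x (α y)

  Reaches-trans : ∀ {x y z} → Reaches x y → Reaches y z → Reaches x z
  Reaches-trans r start = r
  Reaches-trans r (viaσ r′) = viaσ (Reaches-trans r r′)
  Reaches-trans r (viaα r′) = viaα (Reaches-trans r r′)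

  Reaches-σ-iterate : ∀ x k → Reaches x (iterate σ k x)
  Reaches-σ-iterate x zero = start
  Reaches-σ-iterate x (suc k) = viaσ (Reaches-σ-iterate x k)

  Reaches-face-iterate : ∀ x k → Reaches x (iterate (λ z → α (σ z)) k x)
  Reaches-face-iterate x zero = start
  Reaches-face-iterate x (suc k) = viaα (viaσ (Reaches-face-iterate x k))

  Reaches-< : ∀ {x y} → x < n → Reaches x y → y < n
  Reaches-< x< start = x<
  Reaches-< x< (viaσ r) = f< σ-inverse (Reaches-< x< r)
  Reaches-< x< (viaα r) = f< α-inverse (Reaches-< x< r)

  toReach : ∀ (x : Fin n) {y} → Reaches (toℕ x) y → (y< : y < n) → Reach σP αP x (fromℕ< y<)
  toReach x start y< = subst (Reach σP αP x) (sym (toℕ-injective (toℕ-fromℕ< y<))) here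
  toReach x (viaσ {y} r) σy< =
    subst (Reach σP αP x) (toℕ-injective (trans (toℕ-toPermutation σ-inverse _)
                                               (trans (cong σ (toℕ-fromℕ< y<)) (sym (toℕ-fromℕ< σy<)))))
          (stepσ (toReach x r y<))
    where y< = Reaches-< (toℕ<n x) r
  toReach x (viaα {y} r) αy< =
    subst (Reach σP αP x) (toℕ-injective (trans (toℕ-toPermutation α-inverse _)
                                               (trans (cong α (toℕ-fromℕ< y<)) (sym (toℕ-fromℕ< αy<)))))
          (stepα (toReach x r y<))
    where y< = Reaches-< (toℕ<n x) r

  to-and-from-face : ∀ {x} → x < n → ∃ λ z → z ∈ F × Reaches x z × Reaches z x
  to-and-from-face x< with ∈-concat⁻′ Bs (∈-resp-↭ (↭-sym σ-covers) (∈-downFrom⁺ x<))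
  ... | C , x∈C , C∈ with find (All.lookup σ-meets-face C∈)
  ... | z , z∈C , z∈F with Cycle-reaches C (All.lookup σ-cycles C∈) x∈C z∈C | Cycle-reaches C (All.lookup σ-cycles C∈) z∈C x∈C
  ... | k , x→z | k′ , z→x = z , z∈F , subst (Reaches _) x→z (Reaches-σ-iterate _ k) , subst (Reaches _) z→x (Reaches-σ-iterate _ k′)

  within-face : ∀ {z z′} → z ∈ F → z′ ∈ F → Reaches z z′
  within-face z∈ z′∈ with Cycle-reaches F face-cycle z∈ z′∈
  ... | k , e = subst (Reaches _) e (Reaches-face-iterate _ k)

  connected : ∀ x y → Reach σP αP x y
  connected x y with to-and-from-face (toℕ<n x) | to-and-from-face (toℕ<n y)
  ... | z , z∈ , x→z , _ | z′ , z′∈ , _ , z′→y =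
    subst (Reach σP αP x) (fromℕ<-toℕ y (toℕ<n y))
          (toReach x (Reaches-trans x→z (Reaches-trans (within-face z∈ z′∈) z′→y)) (toℕ<n y))

labeling-↭ : ∀ {n f g} (B : InverseBelow n f g) Cs → All (Cycle f) Cs → concat Cs ↭ downFrom n → (Π : Datum) →
             map length Cs ↭ weights Π → CycleLabeling (toPermutation B) Π
labeling-↭ B Cs cycles covers Π lengths with ↭-map-inv length lengths
... | Cs′ , weights≡ , Cs↭ =
  Labeling.labeling B Cs′ (All-resp-↭ Cs↭ cycles) (↭-trans (↭-concat (↭-sym Cs↭)) covers) Π (sym weights≡)

length-map-[_] : (D : List ℕ) → map length (map [_] D) ≡ replicate (length D) 1
length-map-[ [] ] = refl
length-map-[ d ∷ D ] = cong (1 ∷_) length-map-[ D ]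

toLabeledHypermap : ∀ (Ξ : Passport) {Bs Ws F D m} → QuasiOneFaceMap (edges Ξ) Bs Ws F D →
                    map length Bs ↭ weights (Π₁ Ξ) → map length Ws ↭ weights (Π₂ Ξ) → length F ≡ m →
                    weights (Π₃ Ξ) ↭ m ∷ replicate (edges Ξ ∸ m) 1 → LabeledHypermap Ξ
toLabeledHypermap Ξ {F = []} M _ _ _ _ = ⊥-elim (QuasiOneFaceMap.face-cycle M)
toLabeledHypermap Ξ {Bs} {Ws} {c ∷ L} {D} {m} M blacks whites |F| faces = record
  { map = record { σ = toPermutation σ-inverse ; α = toPermutation α-inverse ; φ = toPermutation φ-inverse
                 ; product = product ; connected = Connectivity.connected M }
  ; lab₁ = labeling-↭ σ-inverse Bs σ-cycles σ-covers (Π₁ Ξ) blacks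
  ; lab₂ = labeling-↭ α-inverse Ws α-cycles α-covers (Π₂ Ξ) whites
  ; lab₃ = labeling-↭ φ-inverse ((c ∷ reverse L) ∷ map [_] D) (big-face ∷ map⁺ fixed-faces) face-covers′ (Π₃ Ξ)
                      (↭-trans (↭-reflexive face-lengths) (↭-sym faces))
  }
  where
  open QuasiOneFaceMap M
  n = edges Ξ
  φ = λ x → σ⁻¹ (α⁻¹ x)
  φ-inverse : InverseBelow n φ (λ x → α (σ x))
  φ-inverse = InverseBelow-∘ (InverseBelow-sym σ-inverse) (InverseBelow-sym α-inverse)
  product : ∀ x → toPermutation φ-inverse ⟨$⟩ʳ (toPermutation α-inverse ⟨$⟩ʳ (toPermutation σ-inverse ⟨$⟩ʳ x)) ≡ x
  product x = toℕ-injective (begin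
    toℕ (toPermutation φ-inverse ⟨$⟩ʳ _)  ≡⟨ toℕ-toPermutation φ-inverse _ ⟩
    φ (toℕ (toPermutation α-inverse ⟨$⟩ʳ _)) ≡⟨ cong φ (toℕ-toPermutation α-inverse _) ⟩
    φ (α (toℕ (toPermutation σ-inverse ⟨$⟩ʳ x))) ≡⟨ cong (λ y → φ (α y)) (toℕ-toPermutation σ-inverse x) ⟩
    φ (α (σ (toℕ x)))                     ≡⟨ f∘g φ-inverse (toℕ<n x) ⟩
    toℕ x                                 ∎)
    where open ≡-Reasoning
  big-face : Cycle φ (c ∷ reverse L)
  big-face = Chain-reverse L face-cycle (λ z∈ → f∘g φ-inverse (∈-↭downFrom⁻ face-covers (∈-++⁺ˡ z∈)))
  fixed-faces : All (λ d → Cycle φ [ d ]) D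
  fixed-faces = All.tabulate λ d∈ →
    trans (cong φ (sym (All.lookup face-fixed d∈))) (f∘g φ-inverse (∈-↭downFrom⁻ face-covers (∈-++⁺ʳ (c ∷ L) d∈)))
  face-covers′ : concat ((c ∷ reverse L) ∷ map [_] D) ↭ downFrom n
  face-covers′ = ↭-trans (prep c (↭-trans (↭-reflexive (cong (reverse L ++_) (concat-map-[ D ]))) (++⁺ʳ D (↭-reverse L))))
                         face-covers
  |D| : length D ≡ n ∸ m
  |D| = trans (sym (m+n∸m≡n (length (c ∷ L)) (length D)))
              (cong₂ _∸_ (trans (sym (length-++ (c ∷ L))) (trans (↭-length face-covers) (length-downFrom n))) |F|)
  face-lengths : map length ((c ∷ reverse L) ∷ map [_] D) ≡ m ∷ replicate (n ∸ m) 1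
  face-lengths = cong₂ _∷_ (trans (cong suc (length-reverse L)) |F|)
                           (trans length-map-[ D ] (cong (λ k → replicate k 1) |D|))

sum-replicate : ∀ k v → sum (replicate k v) ≡ k * v
sum-replicate zero v = refl
sum-replicate (suc k) v = cong (v +_) (sum-replicate k v)

sum-weightsFrom : ∀ {k} (m w : Fin k → ℕ) → sum (weightsFrom m w) ≡ ∑ (λ s → m s * w s)
sum-weightsFrom {zero} m w = refl
sum-weightsFrom {suc k} m w =
  trans (sum-++ (replicate (m Fin.zero) (w Fin.zero)) _)
        (cong₂ _+_ (sum-replicate (m Fin.zero) (w Fin.zero)) (sum-weightsFrom (λ s → m (Fin.suc s)) (λ s → w (Fin.suc s))))

length-weightsFrom : ∀ {k} (m w : Fin k → ℕ) → length (weightsFrom m w) ≡ ∑ m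
length-weightsFrom {zero} m w = refl
length-weightsFrom {suc k} m w =
  trans (length-++ (replicate (m Fin.zero) (w Fin.zero)))
        (cong₂ _+_ (length-replicate (m Fin.zero)) (length-weightsFrom (λ s → m (Fin.suc s)) (λ s → w (Fin.suc s))))

weightsFrom-positive : ∀ {k} (m w : Fin k → ℕ) → (∀ s → 1 ≤ w s) → Positive (weightsFrom m w)
weightsFrom-positive {zero} m w _ = []
weightsFrom-positive {suc k} m w pos =
  ++⁺ (replicate⁺ (m Fin.zero) (pos Fin.zero)) (weightsFrom-positive (λ s → m (Fin.suc s)) (λ s → w (Fin.suc s)) (λ s → pos (Fin.suc s)))

sum-weights : ∀ Π → sum (weights Π) ≡ total Π
sum-weights Π = sum-weightsFrom (mult Π) (wt Π)

length-weights : ∀ Π → length (weights Π) ≡ count Π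
length-weights Π = length-weightsFrom (mult Π) (wt Π)

weights-positive : ∀ Π → Positive (weights Π)
weights-positive Π = weightsFrom-positive (mult Π) (wt Π) (wt-pos Π)

1≤length-weights : ∀ Π → 1 ≤ length (weights Π)
1≤length-weights Π = subst (1 ≤_) (sym (length-weights Π)) (1≤∑ (mult Π) (nonempty Π) (mult-pos Π))
  where
  1≤∑ : ∀ {k} (m : Fin k → ℕ) → 1 ≤ k → (∀ s → 1 ≤ m s) → 1 ≤ ∑ m
  1≤∑ {suc k} m _ pos = ≤-trans (pos Fin.zero) (m≤m+n _ _)

Passport-degrees : ∀ Ξ → Degrees (weights (Π₁ Ξ)) (weights (Π₂ Ξ)) (edges Ξ)
Passport-degrees Ξ = degrees (weights-positive (Π₁ Ξ)) (weights-positive (Π₂ Ξ))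
                             (trans (sum-weights (Π₁ Ξ)) (total₁ Ξ)) (trans (sum-weights (Π₂ Ξ)) (total₂ Ξ))

quasiOneFace-euler : ∀ {m} Ξ → IsQuasiOneFace m Ξ →
                     length (weights (Π₁ Ξ)) + length (weights (Π₂ Ξ)) + 2 * genus Ξ ≡ suc m
quasiOneFace-euler {m} Ξ (_ , m≤n , faces) = suc-injective (+-cancelˡ-≡ d _ _ (begin
  d + suc (A + B + 2 * g)                         ≡⟨ regroup A B d g ⟩
  A + B + suc d + 2 * g                           ≡⟨ cong₂ (λ x y → x + y + suc d + 2 * g) (length-weights (Π₁ Ξ)) (length-weights (Π₂ Ξ)) ⟩
  count (Π₁ Ξ) + count (Π₂ Ξ) + suc d + 2 * g     ≡⟨ cong (λ c → count (Π₁ Ξ) + count (Π₂ Ξ) + c + 2 * g) (sym count₃) ⟩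
  count (Π₁ Ξ) + count (Π₂ Ξ) + count (Π₃ Ξ) + 2 * g ≡⟨ euler Ξ ⟩
  edges Ξ + 2                                     ≡⟨ cong (_+ 2) (sym (m+[n∸m]≡n m≤n)) ⟩
  m + d + 2                                       ≡⟨ regroup′ m d ⟩
  d + suc (suc m)                                 ∎))
  where
  open ≡-Reasoning
  A = length (weights (Π₁ Ξ))
  B = length (weights (Π₂ Ξ))
  d = edges Ξ ∸ m
  g = genus Ξ
  count₃ : count (Π₃ Ξ) ≡ suc d
  count₃ = trans (sym (length-weights (Π₃ Ξ))) (trans (↭-length faces) (cong suc (length-replicate d)))
  regroup : ∀ A B d g → d + suc (A + B + 2 * g) ≡ A + B + suc d + 2 * g
  regroup = solve-∀
  regroup′ : ∀ m d → m + d + 2 ≡ d + suc (suc m)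
  regroup′ = solve-∀

corollary1p12 : (m : ℕ) (Ξ : Passport) → IsQuasiOneFace m Ξ → 0 < genus Ξ → LabeledHypermap Ξ
corollary1p12 m Ξ qof@(_ , m≤n , faces) 0<g = toLabeledHypermap Ξ hypermap black-degrees white-degrees face-degree faces
  where
  no-leaf-needed : genus Ξ ≡ 0 → 1 ∈ weights (Π₁ Ξ) ⊎ 1 ∈ weights (Π₂ Ξ)
  no-leaf-needed g≡0 = ⊥-elim (<⇒≢ 0<g (sym g≡0))
  open Realizable (realizable (genus Ξ) (Passport-degrees Ξ) (1≤length-weights (Π₁ Ξ)) (1≤length-weights (Π₂ Ξ))
                              (quasiOneFace-euler Ξ qof) m≤n no-leaf-needed)
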